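{- Let $M$ and $N$ be matroids on disjoint finite sets $S$ and $T$, and let $A\subseteq S$, $B\subseteq T$. If $A_0$ is a basis of $M|A$ and $X\subseteq (S-A_0)\cup T$, then \[(M,N;A,B)\setminus X=(M\setminus(X\cap S),\,N\setminus(X\cap T);\,A-X,\,B-X).\] Dually, if $B_0$ is a basis of $N^*|B$ and $X\subseteq S\cup(T-B_0)$, then \[(M,N;A,B)/X=(M/(X\cap S),\,N/(X\cap T);\,A-X,\,B-X).\]
   Context: For matroids $M'$ on $S'$ and $N'$ on $T'$ with $S'\cap T'=\emptyset$, and $A'\subseteq S'$, $B'\subseteq T'$, the principal sum $(M',N';A',B')$ is the matroid union $M'^+(A',B')\vee N'_0$, where: $N'_0=N'\oplus U_{0,S'}$ ($N'$ with the elements of $S'$ added as loops); $M'^+(A',B')$ is the matroid on $S'\cup T'$ obtained from $M'$ by adding each element of $B'$ freely (by successive principal extensions) to the flat $\mathrm{cl}_{M'}(A')$ and each element of $T'-B'$ as a loop, equivalently the matroid with rank function $r(X\cup Y)=\min\{r_{M'}(X\cup A'),\,r_{M'}(X)+|Y\cap B'|\}$ for $X\subseteq S'$, $Y\subseteq T'$; and the matroid union $G\vee H$ of matroids on a common set has as independent sets the unions of an independent set of $G$ and an independent set of $H$. -}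

module Defs where

open import Data.Nat using (ℕ; zero; suc; _+_; _∸_; _⊓_; _⊔_; _≤_)
open import Data.Bool using (Bool; true; false; if_then_else_; _∧_)
open import Data.Vec using (Vec; []; _∷_)
open import Data.List using (List; []; _∷_; map; _++_; foldr; concatMap)
open import Data.Product using (_×_)
open import Data.Fin.Subset
  using (Subset; outside; inside; _∈_; _∉_; _⊆_; _∩_; _∪_; _─_; ∣_∣; Empty)
open import Data.Fin.Subset.Properties using (_⊆?_)
open import Data.Fin using (Fin)
open import Relation.Nullary using (does; ¬_)
open import Relation.Binary.PropositionalEquality using (_≡_)
import Data.Nat as Nat

-- Matroids, given by rank functions, living inside the finite universe
-- Fin n.  A matroid has a ground set E ⊆ Fin n and a rank function rk;
-- only the values of rk on subsets of E are meaningful.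

record RankData (n : ℕ) : Set where
  constructor mkRankData
  field
    E  : Subset n
    rk : Subset n → ℕ
open RankData public

record IsMatroid {n : ℕ} (M : RankData n) : Set where
  field
    R1 : ∀ X → X ⊆ E M → rk M X ≤ ∣ X ∣
    R2 : ∀ X Y → X ⊆ Y → Y ⊆ E M → rk M X ≤ rk M Y
    R3 : ∀ X Y → X ⊆ E M → Y ⊆ E M →
         rk M (X ∪ Y) + rk M (X ∩ Y) ≤ rk M X + rk M Y

infix 4 _≅_
_≅_ : ∀ {n} → RankData n → RankData n → Set
M ≅ N = (E M ≡ E N) × (∀ Z → Z ⊆ E M → rk M Z ≡ rk N Z)

Disjoint : ∀ {n} → Subset n → Subset n → Set
Disjoint S T = Empty (S ∩ T)

Indep : ∀ {n} → RankData n → Subset n → Set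
Indep M I = (I ⊆ E M) × (rk M I ≡ ∣ I ∣)

indep? : ∀ {n} → RankData n → Subset n → Bool
indep? M I = does (I ⊆? E M) ∧ does (rk M I Nat.≟ ∣ I ∣)

restrict : ∀ {n} → RankData n → Subset n → RankData n
restrict M A = mkRankData (A ∩ E M) (λ Y → rk M (Y ∩ (A ∩ E M)))

IsBasis : ∀ {n} → RankData n → Subset n → Set
IsBasis M B = Indep M B × (∀ J → B ⊆ J → Indep M J → J ≡ B)

del : ∀ {n} → RankData n → Subset n → RankData n
del M X = mkRankData (E M ─ X) (λ Y → rk M (Y ∩ (E M ─ X)))

con : ∀ {n} → RankData n → Subset n → RankData n
con M X = mkRankData (E M ─ X)
  (λ Y → rk M ((Y ∩ (E M ─ X)) ∪ (X ∩ E M)) ∸ rk M (X ∩ E M))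

dual : ∀ {n} → RankData n → RankData n
dual M = mkRankData (E M)
  (λ Y → (∣ Y ∩ E M ∣ + rk M (E M ─ Y)) ∸ rk M (E M))

-- M⁺(A,B) on S ∪ T (S = E M):
--   r(X ∪ Y) = min { r_M(X ∪ A), r_M(X) + |Y ∩ B| }
plusExt : ∀ {n} → RankData n → (T A B : Subset n) → RankData n
plusExt M T A B = mkRankData (E M ∪ T)
  (λ Z → rk M ((Z ∩ E M) ∪ A) ⊓ (rk M (Z ∩ E M) + ∣ (Z ∩ T) ∩ B ∣))

-- N₀ = N ⊕ U_{0,S}
addLoops : ∀ {n} → RankData n → (S : Subset n) → RankData n
addLoops N S = mkRankData (E N ∪ S) (λ Z → rk N (Z ∩ E N))

allSubsets : (n : ℕ) → List (Subset n)
allSubsets zero    = [] ∷ []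
allSubsets (suc n) = map (outside ∷_) (allSubsets n) ++ map (inside ∷_) (allSubsets n)

maxList : List ℕ → ℕ
maxList = foldr _⊔_ 0

-- Matroid union G ∨ H on the common ground set E G:
-- independent sets are I₁ ∪ I₂ with I₁ independent in G and I₂ in H;
-- the rank of Z is the largest size of such an independent subset of Z.
unionM : ∀ {n} → RankData n → RankData n → RankData n
unionM {n} G H = mkRankData (E G) (λ Z → maxList
  (concatMap (λ I₁ → map (λ I₂ →
      if does (I₁ ⊆? (Z ∩ E G)) ∧ does (I₂ ⊆? (Z ∩ E G)) ∧ indep? G I₁ ∧ indep? H I₂
      then ∣ I₁ ∪ I₂ ∣ else 0)
    (allSubsets n)) (allSubsets n)))

-- (M, N; A, B) = M⁺(A,B) ∨ N₀
principalSum : ∀ {n} → RankData n → RankData n → Subset n → Subset n → RankData n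
principalSum M N A B = unionM (plusExt M (E N) A B) (addLoops N (E M))

module Submission where

-- Everything goes through a closed formula for the rank of a principal sum:
-- for Z ⊆ S ∪ T with traces Z_S = Z ∩ S and Z_T = Z ∩ T,
--   r(M,N;A,B)(Z) = min { r_M(Z_S ∪ A) + r_N(Z_T) , r_M(Z_S) + r_N(Z_T ─ B) + |Z_T ∩ B| } .
-- It is proved by bounding every independent pair of M⁺(A,B) ∨ N₀ inside Z,
-- and by exhibiting a pair attaining the bound: a basis of Z_S, a basis of
-- Z_T extending one of Z_T ─ B, and as many further elements of B as fit.
-- Both sides of each identity of the corollary are then evaluated with this
-- formula.  For deletion the only term that is not a plain restriction is
-- r_M(Z_S ∪ A), unchanged when A loses elements outside a basis A₀ of M|A.
-- For contraction one needs that a set W ⊆ T avoiding a basis B₀ of N*|B has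
-- rank r_N(W ─ B) + |W ∩ B|, after which the formula for the contraction is
-- the difference of two instances of the formula.

open import Defs
open import Data.Nat using (ℕ; zero; suc; _+_; _∸_; _⊓_; _≤_; _≤?_; z≤n; s≤s)
import Data.Nat as Nat
open import Data.Nat.Properties
open import Data.Nat.Tactic.RingSolver using (solve-∀)
open import Data.Bool using (Bool; true; false; if_then_else_; _∧_; _∨_; not)
open import Data.Vec using (Vec; []; _∷_; lookup; map; head; tail; here; there)
open import Data.Vec.Properties using (lookup-map)
open import Data.List using (List; []; _∷_)
import Data.List as L
open import Data.List.Relation.Unary.All using (All; universal)
open import Data.List.Relation.Unary.All.Properties using (concat⁺; map⁺)
import Data.List.Relation.Unary.Any as Any
open import Data.List.Membership.Propositional using () renaming (_∈_ to _∈ˡ_)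
open import Data.List.Membership.Propositional.Properties using (∈-map⁺; ∈-concatMap⁺; ∈-++⁺ˡ; ∈-++⁺ʳ)
open import Data.Product using (_×_; _,_; Σ; proj₁; proj₂)
open import Data.Fin using (Fin; zero; suc)
open import Data.Fin.Properties using (any?)
open import Data.Fin.Subset
  using (Subset; outside; inside; _∈_; _∉_; _⊆_; _∩_; _∪_; _─_; ∣_∣; ⊥; ⁅_⁆)
open import Data.Fin.Subset.Properties
open import Data.Unit using (⊤; tt)
open import Data.Empty using (⊥-elim)
open import Data.Sum using (inj₁; inj₂)
open import Relation.Nullary using (Dec; yes; no; does; ¬_)
open import Relation.Nullary.Decidable using (_×-dec_; ¬?; dec-true)
open import Relation.Binary.PropositionalEquality

-- Equalities between Boolean combinations of subsets, valid under hypotheses of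
-- the form  e ≡ ⊥ , are decided coordinatewise: a subset of Fin (suc n) is its
-- head bit followed by a subset of Fin n, and all operations act bitwise.  So
-- it suffices to check the identity for the 2^k Boolean assignments of the k
-- variables, which the type checker does by evaluation.

data SetExpr (k : ℕ) : Set where
  var            : Fin k → SetExpr k
  ∅ₑ             : SetExpr k
  _∩ₑ_ _∪ₑ_ _─ₑ_ : SetExpr k → SetExpr k → SetExpr k

infixr 7 _∩ₑ_
infixr 6 _∪ₑ_
infixl 5 _─ₑ_

⟦_⟧ : ∀ {n k} → SetExpr k → Vec (Subset n) k → Subset n
⟦ var i ⟧  ρ = lookup ρ i
⟦ ∅ₑ ⟧     ρ = ⊥
⟦ a ∩ₑ b ⟧ ρ = ⟦ a ⟧ ρ ∩ ⟦ b ⟧ ρ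
⟦ a ∪ₑ b ⟧ ρ = ⟦ a ⟧ ρ ∪ ⟦ b ⟧ ρ
⟦ a ─ₑ b ⟧ ρ = ⟦ a ⟧ ρ ─ ⟦ b ⟧ ρ

diffᵇ : Bool → Bool → Bool
diffᵇ x y = head ((x ∷ []) ─ (y ∷ []))

⟦_⟧ᵇ : ∀ {k} → SetExpr k → Vec Bool k → Bool
⟦ var i ⟧ᵇ  β = lookup β i
⟦ ∅ₑ ⟧ᵇ     β = false
⟦ a ∩ₑ b ⟧ᵇ β = ⟦ a ⟧ᵇ β ∧ ⟦ b ⟧ᵇ β
⟦ a ∪ₑ b ⟧ᵇ β = ⟦ a ⟧ᵇ β ∨ ⟦ b ⟧ᵇ β
⟦ a ─ₑ b ⟧ᵇ β = diffᵇ (⟦ a ⟧ᵇ β) (⟦ b ⟧ᵇ β)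

∷-η : ∀ {A : Set} {n} (x : Vec A (suc n)) → x ≡ head x ∷ tail x
∷-η (x ∷ xs) = refl

∷-injective : ∀ {A : Set} {n} {x y : A} {xs ys : Vec A n} →
  x ∷ xs ≡ y ∷ ys → (x ≡ y) × (xs ≡ ys)
∷-injective refl = refl , refl

⟦⟧-∷ : ∀ {n k} (e : SetExpr k) (ρ : Vec (Subset (suc n)) k) →
  ⟦ e ⟧ ρ ≡ ⟦ e ⟧ᵇ (map head ρ) ∷ ⟦ e ⟧ (map tail ρ)
⟦⟧-∷ (var i) ρ rewrite lookup-map i head ρ | lookup-map i tail ρ = ∷-η (lookup ρ i)
⟦⟧-∷ ∅ₑ ρ = refl
⟦⟧-∷ (a ∩ₑ b) ρ rewrite ⟦⟧-∷ a ρ | ⟦⟧-∷ b ρ = refl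
⟦⟧-∷ (a ∪ₑ b) ρ rewrite ⟦⟧-∷ a ρ | ⟦⟧-∷ b ρ = refl
⟦⟧-∷ (a ─ₑ b) ρ rewrite ⟦⟧-∷ a ρ | ⟦⟧-∷ b ρ with ⟦ b ⟧ᵇ (map head ρ)
... | true  = refl
... | false = refl

AllEmpty : ∀ {n k} → List (SetExpr k) → Vec (Subset n) k → Set
AllEmpty []       ρ = ⊤
AllEmpty (h ∷ hs) ρ = (⟦ h ⟧ ρ ≡ ⊥) × AllEmpty hs ρ

allFalse : ∀ {k} → List (SetExpr k) → Vec Bool k → Bool
allFalse []       β = true
allFalse (h ∷ hs) β = not (⟦ h ⟧ᵇ β) ∧ allFalse hs β

_==_ : Bool → Bool → Bool
true  == true  = true
false == false = true
_     == _     = false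

==⇒≡ : ∀ a b → (a == b) ≡ true → a ≡ b
==⇒≡ true  true  _ = refl
==⇒≡ false false _ = refl

∧-true₁ : ∀ {a b} → (a ∧ b) ≡ true → a ≡ true
∧-true₁ {true} _ = refl

∧-true₂ : ∀ {a b} → (a ∧ b) ≡ true → b ≡ true
∧-true₂ {true} p = p

forAll : ∀ k → (Vec Bool k → Bool) → Bool
forAll zero    f = f []
forAll (suc k) f = forAll k (λ β → f (true ∷ β)) ∧ forAll k (λ β → f (false ∷ β))

forAll-sound : ∀ k f → forAll k f ≡ true → ∀ β → f β ≡ true
forAll-sound zero    f p []          = p
forAll-sound (suc k) f p (true ∷ β)  = forAll-sound k _ (∧-true₁ p) β
forAll-sound (suc k) f p (false ∷ β) =
  forAll-sound k _ (∧-true₂ {forAll k (λ β → f (true ∷ β))} p) β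

valid : ∀ k → List (SetExpr k) → SetExpr k → SetExpr k → Bool
valid k hs a b = forAll k (λ β → not (allFalse hs β) ∨ (⟦ a ⟧ᵇ β == ⟦ b ⟧ᵇ β))

hyps-∷ : ∀ {n k} (hs : List (SetExpr k)) (ρ : Vec (Subset (suc n)) k) → AllEmpty hs ρ →
  (allFalse hs (map head ρ) ≡ true) × AllEmpty hs (map tail ρ)
hyps-∷ []       ρ _        = refl , tt
hyps-∷ (h ∷ hs) ρ (p , ps) with ∷-injective (trans (sym (⟦⟧-∷ h ρ)) p) | hyps-∷ hs ρ ps
... | hd , tl | q , qs rewrite hd = q , (tl , qs)

implies : ∀ {a b} → (not a ∨ b) ≡ true → a ≡ true → b ≡ true
implies {true} p refl = p

Vec₀-unique : ∀ {A : Set} (x y : Vec A 0) → x ≡ y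
Vec₀-unique [] [] = refl

sound : ∀ {n k} (hs : List (SetExpr k)) (a b : SetExpr k) → valid k hs a b ≡ true →
  (ρ : Vec (Subset n) k) → AllEmpty hs ρ → ⟦ a ⟧ ρ ≡ ⟦ b ⟧ ρ
sound {zero} hs a b ok ρ h = Vec₀-unique _ _
sound {suc n} {k} hs a b ok ρ h rewrite ⟦⟧-∷ a ρ | ⟦⟧-∷ b ρ with hyps-∷ hs ρ h
... | hd , tl = cong₂ _∷_ (==⇒≡ _ _ (implies (forAll-sound k _ ok (map head ρ)) hd))
                          (sound hs a b ok (map tail ρ) tl)

v₀ : ∀ {k} → SetExpr (suc k)
v₀ = var zero
v₁ : ∀ {k} → SetExpr (suc (suc k))
v₁ = var (suc zero)
v₂ : ∀ {k} → SetExpr (suc (suc (suc k)))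
v₂ = var (suc (suc zero))
v₃ : ∀ {k} → SetExpr (suc (suc (suc (suc k))))
v₃ = var (suc (suc (suc zero)))
v₄ : ∀ {k} → SetExpr (suc (suc (suc (suc (suc k)))))
v₄ = var (suc (suc (suc (suc zero))))
v₅ : ∀ {k} → SetExpr (suc (suc (suc (suc (suc (suc k))))))
v₅ = var (suc (suc (suc (suc (suc zero)))))
v₆ : ∀ {k} → SetExpr (suc (suc (suc (suc (suc (suc (suc k)))))))
v₆ = var (suc (suc (suc (suc (suc (suc zero))))))
v₇ : ∀ {k} → SetExpr (suc (suc (suc (suc (suc (suc (suc (suc k))))))))
v₇ = var (suc (suc (suc (suc (suc (suc (suc zero)))))))

-- Inclusions enter and leave the procedure as  p ─ q ≡ ⊥ .
⊆⇒─≡⊥ : ∀ {n} {p q : Subset n} → p ⊆ q → p ─ q ≡ ⊥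
⊆⇒─≡⊥ {p = []}    {[]}         h = refl
⊆⇒─≡⊥ {p = x ∷ p} {true ∷ q}  h = cong (outside ∷_) (⊆⇒─≡⊥ (drop-∷-⊆ h))
⊆⇒─≡⊥ {p = false ∷ p} {false ∷ q} h = cong (outside ∷_) (⊆⇒─≡⊥ (drop-∷-⊆ h))
⊆⇒─≡⊥ {p = true ∷ p}  {false ∷ q} h with h here
... | ()

─≡⊥⇒⊆ : ∀ {n} {p q : Subset n} → p ─ q ≡ ⊥ → p ⊆ q
─≡⊥⇒⊆ {p = x ∷ p}    {true ∷ q}  e here      = here
─≡⊥⇒⊆ {p = true ∷ p} {false ∷ q} () here
─≡⊥⇒⊆ {p = x ∷ p}    {true ∷ q}  e (there i) = there (─≡⊥⇒⊆ (proj₂ (∷-injective e)) i)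
─≡⊥⇒⊆ {p = x ∷ p}    {false ∷ q} e (there i) = there (─≡⊥⇒⊆ (proj₂ (∷-injective e)) i)

∣∪∣+∣∩∣ : ∀ {n} (p q : Subset n) → ∣ p ∪ q ∣ + ∣ p ∩ q ∣ ≡ ∣ p ∣ + ∣ q ∣
∣∪∣+∣∩∣ [] [] = refl
∣∪∣+∣∩∣ (true ∷ p) (true ∷ q) =
  cong suc (trans (+-suc ∣ p ∪ q ∣ ∣ p ∩ q ∣)
                  (trans (cong suc (∣∪∣+∣∩∣ p q)) (sym (+-suc ∣ p ∣ ∣ q ∣))))
∣∪∣+∣∩∣ (true ∷ p)  (false ∷ q) = cong suc (∣∪∣+∣∩∣ p q)
∣∪∣+∣∩∣ (false ∷ p) (true ∷ q)  = trans (cong suc (∣∪∣+∣∩∣ p q)) (sym (+-suc ∣ p ∣ ∣ q ∣))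
∣∪∣+∣∩∣ (false ∷ p) (false ∷ q) = ∣∪∣+∣∩∣ p q

∣∪∣-disjoint : ∀ {n} (p q : Subset n) → p ∩ q ≡ ⊥ → ∣ p ∪ q ∣ ≡ ∣ p ∣ + ∣ q ∣
∣∪∣-disjoint {n} p q p∩q≡⊥ = begin
  ∣ p ∪ q ∣                ≡⟨ sym (+-identityʳ _) ⟩
  ∣ p ∪ q ∣ + 0            ≡⟨ cong (∣ p ∪ q ∣ +_) (sym (∣⊥∣≡0 n)) ⟩
  ∣ p ∪ q ∣ + ∣ ⊥ {n} ∣    ≡⟨ cong (λ s → ∣ p ∪ q ∣ + ∣ s ∣) (sym p∩q≡⊥) ⟩
  ∣ p ∪ q ∣ + ∣ p ∩ q ∣    ≡⟨ ∣∪∣+∣∩∣ p q ⟩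
  ∣ p ∣ + ∣ q ∣            ∎
  where open ≡-Reasoning

∣∪∣≤ : ∀ {n} (p q : Subset n) → ∣ p ∪ q ∣ ≤ ∣ p ∣ + ∣ q ∣
∣∪∣≤ p q = ≤-trans (m≤m+n _ _) (≤-reflexive (∣∪∣+∣∩∣ p q))

∣∩∣+∣─∣ : ∀ {n} (p q : Subset n) → ∣ p ∣ ≡ ∣ p ∩ q ∣ + ∣ p ─ q ∣
∣∩∣+∣─∣ p q = trans (cong ∣_∣ (sound [] v₀ ((v₀ ∩ₑ v₁) ∪ₑ (v₀ ─ₑ v₁)) refl (p ∷ q ∷ []) tt))
                    (∣∪∣-disjoint (p ∩ q) (p ─ q)
                      (sound [] ((v₀ ∩ₑ v₁) ∩ₑ (v₀ ─ₑ v₁)) ∅ₑ refl (p ∷ q ∷ []) tt))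

∣p∣≡0⇒p≡⊥ : ∀ {n} (p : Subset n) → ∣ p ∣ ≡ 0 → p ≡ ⊥
∣p∣≡0⇒p≡⊥ []          e = refl
∣p∣≡0⇒p≡⊥ (false ∷ p) e = cong (outside ∷_) (∣p∣≡0⇒p≡⊥ p e)

⊆-by-size : ∀ {n} {p q : Subset n} → p ⊆ q → ∣ q ∣ ≤ ∣ p ∣ → q ⊆ p
⊆-by-size {p = p} {q} p⊆q |q|≤|p| =
  ─≡⊥⇒⊆ (∣p∣≡0⇒p≡⊥ (q ─ p) (n≤0⇒n≡0 (+-cancelˡ-≤ ∣ p ∣ _ _ |p|+|q─p|≤|p|)))
  where
  |p|+|q─p|≤|p| : ∣ p ∣ + ∣ q ─ p ∣ ≤ ∣ p ∣ + 0
  |p|+|q─p|≤|p| = begin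
    ∣ p ∣ + ∣ q ─ p ∣     ≡⟨ cong (λ s → ∣ s ∣ + ∣ q ─ p ∣)
                               (sound ((v₀ ─ₑ v₁) ∷ []) v₀ (v₁ ∩ₑ v₀) refl (p ∷ q ∷ []) (⊆⇒─≡⊥ p⊆q , tt)) ⟩
    ∣ q ∩ p ∣ + ∣ q ─ p ∣ ≡⟨ sym (∣∩∣+∣─∣ q p) ⟩
    ∣ q ∣                 ≤⟨ |q|≤|p| ⟩
    ∣ p ∣                 ≡⟨ sym (+-identityʳ _) ⟩
    ∣ p ∣ + 0             ∎
    where open ≤-Reasoning

subset-of-size : ∀ {n} (D : Subset n) k → k ≤ ∣ D ∣ → Σ (Subset n) λ K → (K ⊆ D) × (∣ K ∣ ≡ k)
subset-of-size {n} D zero _ = ⊥ , ⊆-min D , ∣⊥∣≡0 n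
subset-of-size (true ∷ D) (suc k) (s≤s k≤|D|) with subset-of-size D k k≤|D|
... | K , K⊆D , |K| = (true ∷ K) , ∷-⊆ K⊆D , cong suc |K|
  where
  ∷-⊆ : ∀ {n} {K D : Subset n} → K ⊆ D → true ∷ K ⊆ true ∷ D
  ∷-⊆ K⊆D here      = here
  ∷-⊆ K⊆D (there i) = there (K⊆D i)
subset-of-size (false ∷ D) (suc k) k≤|D| with subset-of-size D (suc k) k≤|D|
... | K , K⊆D , |K| = (false ∷ K) , (λ { (there i) → there (K⊆D i) }) , |K|

∪-least : ∀ {n} {p q s : Subset n} → p ⊆ s → q ⊆ s → p ∪ q ⊆ s
∪-least {p = p} {q} p⊆s q⊆s x∈ with x∈p∪q⁻ p q x∈
... | inj₁ x∈p = p⊆s x∈p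
... | inj₂ x∈q = q⊆s x∈q

⁅⁆-⊆ : ∀ {n} {w : Fin n} {p : Subset n} → w ∈ p → ⁅ w ⁆ ⊆ p
⁅⁆-⊆ {w = w} {p} w∈p u∈⁅w⁆ = subst (_∈ p) (sym (x∈⁅y⁆⇒x≡y w u∈⁅w⁆)) w∈p

∈─⇒∉ : ∀ {n} {w : Fin n} (p q : Subset n) → w ∈ p ─ q → w ∉ q
∈─⇒∉ (x ∷ p) (true ∷ q) () here
∈─⇒∉ (x ∷ p) (y ∷ q) (there w∈) (there w∈q) = ∈─⇒∉ p q w∈ w∈q

∉⇒⁅⁆∩≡⊥ : ∀ {n} {w : Fin n} {p : Subset n} → w ∉ p → ⁅ w ⁆ ∩ p ≡ ⊥
∉⇒⁅⁆∩≡⊥ {w = zero}  {false ∷ p} w∉p = cong (outside ∷_) (sound [] (∅ₑ ∩ₑ v₀) ∅ₑ refl (p ∷ []) tt)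
∉⇒⁅⁆∩≡⊥ {w = zero}  {true ∷ p}  w∉p = ⊥-elim (w∉p here)
∉⇒⁅⁆∩≡⊥ {w = suc w} {x ∷ p}     w∉p = cong (outside ∷_) (∉⇒⁅⁆∩≡⊥ (λ w∈p → w∉p (there w∈p)))

module RankFacts {n} (M : RankData n) (isM : IsMatroid M) where
  open IsMatroid isM
  private
    r : Subset n → ℕ
    r = rk M
    S : Subset n
    S = E M

  rank-⊥ : r ⊥ ≡ 0
  rank-⊥ = n≤0⇒n≡0 (≤-trans (R1 ⊥ (⊆-min S)) (≤-reflexive (∣⊥∣≡0 n)))

  rank-mono : ∀ {X Y} → X ⊆ Y → Y ⊆ S → r X ≤ r Y
  rank-mono {X} {Y} = R2 X Y

  rank-∪≤ : ∀ P Q → P ⊆ S → Q ⊆ S → r (P ∪ Q) ≤ r P + r Q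
  rank-∪≤ P Q P⊆S Q⊆S = ≤-trans (m≤m+n _ _) (R3 P Q P⊆S Q⊆S)

  independent-⊆ : ∀ J I → J ⊆ I → I ⊆ S → r I ≡ ∣ I ∣ → r J ≡ ∣ J ∣
  independent-⊆ J I J⊆I I⊆S rI = ≤-antisym (R1 J (⊆-trans J⊆I I⊆S)) (+-cancelʳ-≤ _ _ _ chain)
    where
    ρ = J ∷ I ∷ []
    hyp = ⊆⇒─≡⊥ J⊆I , tt
    I─J⊆S : I ─ J ⊆ S
    I─J⊆S = ⊆-trans (p─q⊆p I J) I⊆S
    chain : ∣ J ∣ + ∣ I ─ J ∣ ≤ r J + ∣ I ─ J ∣
    chain = begin
      ∣ J ∣ + ∣ I ─ J ∣      ≡⟨ cong (λ s → ∣ s ∣ + ∣ I ─ J ∣)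
                                  (sound ((v₀ ─ₑ v₁) ∷ []) v₀ (v₁ ∩ₑ v₀) refl ρ hyp) ⟩
      ∣ I ∩ J ∣ + ∣ I ─ J ∣  ≡⟨ sym (∣∩∣+∣─∣ I J) ⟩
      ∣ I ∣                  ≡⟨ sym rI ⟩
      r I                    ≡⟨ cong r (sound ((v₀ ─ₑ v₁) ∷ []) v₁ (v₀ ∪ₑ (v₁ ─ₑ v₀)) refl ρ hyp) ⟩
      r (J ∪ (I ─ J))        ≤⟨ rank-∪≤ J (I ─ J) (⊆-trans J⊆I I⊆S) I─J⊆S ⟩
      r J + r (I ─ J)        ≤⟨ +-monoʳ-≤ (r J) (R1 (I ─ J) I─J⊆S) ⟩
      r J + ∣ I ─ J ∣        ∎
      where open ≤-Reasoning

  absorbs : ∀ I D → I ⊆ S → D ⊆ S →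
            (∀ w → w ∈ D → r (I ∪ ⁅ w ⁆) ≤ r I) → r (I ∪ D) ≤ r I
  absorbs I D I⊆S D⊆S = go ∣ D ∣ D ≤-refl D⊆S
    where
    go : ∀ k D → ∣ D ∣ ≤ k → D ⊆ S → (∀ w → w ∈ D → r (I ∪ ⁅ w ⁆) ≤ r I) → r (I ∪ D) ≤ r I
    go k D |D|≤k D⊆S h with nonempty? D
    ... | no ¬ne = ≤-reflexive (cong r (trans (cong (I ∪_) (Empty-unique ¬ne))
                                              (sound [] (v₀ ∪ₑ ∅ₑ) v₀ refl (I ∷ []) tt)))
    go zero D |D|≤0 D⊆S h | yes (w , w∈D) =
      ⊥-elim (1+n≰n (≤-trans (≤-trans (s≤s z≤n) (x∈p⇒∣p-x∣<∣p∣ w∈D)) |D|≤0))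
    go (suc k) D |D|≤k D⊆S h | yes (w , w∈D) = +-cancelʳ-≤ _ _ _ (begin
        r (I ∪ D) + r I                        ≤⟨ +-monoʳ-≤ (r (I ∪ D)) (rank-mono I⊆C C⊆S) ⟩
        r (I ∪ D) + r C                        ≡⟨ cong (λ z → r z + r C) (sym D'∪w) ⟩
        r ((I ∪ D') ∪ (I ∪ W)) + r C           ≤⟨ R3 (I ∪ D') (I ∪ W) ID'⊆S IW⊆S ⟩
        r (I ∪ D') + r (I ∪ W)                 ≤⟨ +-mono-≤ smaller (h w w∈D) ⟩
        r I + r I                              ∎)
      where
      open ≤-Reasoning
      W D' C : Subset n
      W  = ⁅ w ⁆
      D' = D ─ W
      C  = (I ∪ D') ∩ (I ∪ W)
      ρ = I ∷ D ∷ W ∷ []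
      hyp = ⊆⇒─≡⊥ (⁅⁆-⊆ w∈D) , tt
      ID'⊆S : I ∪ D' ⊆ S
      ID'⊆S = ∪-least I⊆S (⊆-trans (p─q⊆p D W) D⊆S)
      IW⊆S : I ∪ W ⊆ S
      IW⊆S  = ∪-least I⊆S (⊆-trans (⁅⁆-⊆ w∈D) D⊆S)
      C⊆S   = ⊆-trans (p∩q⊆p _ _) ID'⊆S
      smaller : r (I ∪ D') ≤ r I
      smaller = go k D' (≤-pred (≤-trans (x∈p⇒∣p-x∣<∣p∣ w∈D) |D|≤k)) (⊆-trans (p─q⊆p D W) D⊆S)
                  (λ u u∈ → h u (p─q⊆p D W u∈))
      D'∪w : (I ∪ D') ∪ (I ∪ W) ≡ I ∪ D
      D'∪w = sound ((v₂ ─ₑ v₁) ∷ []) ((v₀ ∪ₑ (v₁ ─ₑ v₂)) ∪ₑ (v₀ ∪ₑ v₂)) (v₀ ∪ₑ v₁) refl ρ hyp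
      I⊆C : I ⊆ C
      I⊆C = ─≡⊥⇒⊆ (sound [] (v₀ ─ₑ ((v₀ ∪ₑ (v₁ ─ₑ v₂)) ∩ₑ (v₀ ∪ₑ v₂))) ∅ₑ refl ρ tt)

  augment : ∀ I w → I ⊆ S → w ∈ S → w ∉ I → r I ≡ ∣ I ∣ → ¬ (r (I ∪ ⁅ w ⁆) ≤ r I) →
            r (I ∪ ⁅ w ⁆) ≡ ∣ I ∪ ⁅ w ⁆ ∣
  augment I w I⊆S w∈S w∉I rI raises = ≤-antisym (R1 _ (∪-least I⊆S (⁅⁆-⊆ w∈S))) (begin
      ∣ I ∪ ⁅ w ⁆ ∣     ≡⟨ size ⟩
      suc ∣ I ∣         ≡⟨ cong suc (sym rI) ⟩
      suc (r I)         ≤⟨ ≰⇒> raises ⟩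
      r (I ∪ ⁅ w ⁆)     ∎)
    where
    open ≤-Reasoning
    size : ∣ I ∪ ⁅ w ⁆ ∣ ≡ suc ∣ I ∣
    size = trans (∣∪∣-disjoint I ⁅ w ⁆ (trans (∩-comm I ⁅ w ⁆) (∉⇒⁅⁆∩≡⊥ w∉I)))
                 (trans (cong (∣ I ∣ +_) (∣⁅x⁆∣≡1 w)) (+-comm ∣ I ∣ 1))

  extend-to-spanning : ∀ W I → W ⊆ S → I ⊆ W → r I ≡ ∣ I ∣ →
    Σ (Subset n) λ J → (I ⊆ J) × (J ⊆ W) × (r J ≡ ∣ J ∣) × (r J ≡ r W)
  extend-to-spanning W I₀ W⊆S = go ∣ W ─ I₀ ∣ I₀ ≤-refl
    where
    go : ∀ k I → ∣ W ─ I ∣ ≤ k → I ⊆ W → r I ≡ ∣ I ∣ →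
         Σ (Subset n) λ J → (I ⊆ J) × (J ⊆ W) × (r J ≡ ∣ J ∣) × (r J ≡ r W)
    go k I size I⊆W rI with any? (λ w → (w ∈? (W ─ I)) ×-dec ¬? (r (I ∪ ⁅ w ⁆) ≤? r I))
    ... | no none = I , ⊆-refl , I⊆W , rI , ≤-antisym (rank-mono I⊆W W⊆S) (begin
          r W              ≡⟨ cong r (sound ((v₁ ─ₑ v₀) ∷ []) v₀ (v₁ ∪ₑ (v₀ ─ₑ v₁)) refl
                                         (W ∷ I ∷ []) (⊆⇒─≡⊥ I⊆W , tt)) ⟩
          r (I ∪ (W ─ I))  ≤⟨ absorbs I (W ─ I) (⊆-trans I⊆W W⊆S) (⊆-trans (p─q⊆p W I) W⊆S) no-raise ⟩
          r I              ∎)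
      where
      open ≤-Reasoning
      no-raise : ∀ w → w ∈ W ─ I → r (I ∪ ⁅ w ⁆) ≤ r I
      no-raise w w∈ with r (I ∪ ⁅ w ⁆) ≤? r I
      ... | yes le = le
      ... | no nle = ⊥-elim (none (w , w∈ , nle))
    go zero I size I⊆W rI | yes (w , w∈ , _) =
      ⊥-elim (1+n≰n (≤-trans (≤-trans (s≤s z≤n) (x∈p⇒∣p-x∣<∣p∣ w∈)) size))
    go (suc k) I size I⊆W rI | yes (w , w∈ , raises)
      with go k (I ∪ ⁅ w ⁆) size' I+w⊆W
              (augment I w (⊆-trans I⊆W W⊆S) (W⊆S w∈W) (∈─⇒∉ W I w∈) rI raises)
      where
      w∈W : w ∈ W
      w∈W = p─q⊆p W I w∈
      I+w⊆W : I ∪ ⁅ w ⁆ ⊆ W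
      I+w⊆W = ∪-least I⊆W (⁅⁆-⊆ w∈W)
      size' : ∣ W ─ (I ∪ ⁅ w ⁆) ∣ ≤ k
      size' = ≤-pred (≤-trans (≤-trans (s≤s (≤-reflexive (cong ∣_∣ (sym (p─q─r≡p─q∪r W I ⁅ w ⁆)))))
                                        (x∈p⇒∣p-x∣<∣p∣ w∈)) size)
    ... | J , I+w⊆J , J⊆W , rJ , rJ≡rW = J , ⊆-trans (p⊆p∪q ⁅ w ⁆) I+w⊆J , J⊆W , rJ , rJ≡rW

  basis-of : ∀ W → W ⊆ S → Σ (Subset n) λ J → (J ⊆ W) × (r J ≡ ∣ J ∣) × (r J ≡ r W)
  basis-of W W⊆S with extend-to-spanning W ⊥ W⊆S (⊆-min W) (trans rank-⊥ (sym (∣⊥∣≡0 n)))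
  ... | J , _ , J⊆W , rJ , rJ≡rW = J , J⊆W , rJ , rJ≡rW

  span-∪ : ∀ {A₀ A' A W} → A₀ ⊆ A' → A' ⊆ A → A ⊆ S → r A ≤ r A₀ → W ⊆ S →
           r (W ∪ A) ≡ r (W ∪ A')
  span-∪ {A₀} {A'} {A} {W} A₀⊆A' A'⊆A A⊆S rA≤rA₀ W⊆S =
    ≤-antisym (+-cancelʳ-≤ _ _ _ chain) (rank-mono WA'⊆WA (∪-least W⊆S A⊆S))
    where
    ρ = A₀ ∷ A' ∷ A ∷ W ∷ []
    hs = (v₀ ─ₑ v₁) ∷ (v₁ ─ₑ v₂) ∷ []
    hyp = ⊆⇒─≡⊥ A₀⊆A' , ⊆⇒─≡⊥ A'⊆A , tt
    WA'⊆WA : W ∪ A' ⊆ W ∪ A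
    WA'⊆WA = ─≡⊥⇒⊆ (sound hs ((v₃ ∪ₑ v₁) ─ₑ (v₃ ∪ₑ v₂)) ∅ₑ refl ρ hyp)
    A₀⊆∩ : A₀ ⊆ (W ∪ A') ∩ A
    A₀⊆∩ = ─≡⊥⇒⊆ (sound hs (v₀ ─ₑ ((v₃ ∪ₑ v₁) ∩ₑ v₂)) ∅ₑ refl ρ hyp)
    chain : r (W ∪ A) + r A ≤ r (W ∪ A') + r A
    chain = begin
      r (W ∪ A) + r A                        ≤⟨ +-monoʳ-≤ (r (W ∪ A))
                                                 (≤-trans rA≤rA₀ (rank-mono A₀⊆∩ (⊆-trans (p∩q⊆q _ _) A⊆S))) ⟩
      r (W ∪ A) + r ((W ∪ A') ∩ A)           ≡⟨ cong (λ z → r z + r ((W ∪ A') ∩ A))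
                                                 (sym (sound hs ((v₃ ∪ₑ v₁) ∪ₑ v₂) (v₃ ∪ₑ v₂) refl ρ hyp)) ⟩
      r ((W ∪ A') ∪ A) + r ((W ∪ A') ∩ A)    ≤⟨ R3 (W ∪ A') A (⊆-trans WA'⊆WA (∪-least W⊆S A⊆S)) A⊆S ⟩
      r (W ∪ A') + r A                       ∎
      where open ≤-Reasoning

  restriction-basis : ∀ A A₀ → A ⊆ S → IsBasis (restrict M A) A₀ →
                      (A₀ ⊆ A) × (r A₀ ≡ ∣ A₀ ∣) × (r A ≤ r A₀)
  restriction-basis A A₀ A⊆S ((A₀⊆A∩S , rA₀) , maximal) = A₀⊆A , indep , spans
    where
    in-A∩S : ∀ {J} → J ⊆ A ∩ S → J ∩ (A ∩ S) ≡ J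
    in-A∩S {J} J⊆ = sound ((v₀ ─ₑ (v₁ ∩ₑ v₂)) ∷ []) (v₀ ∩ₑ (v₁ ∩ₑ v₂)) v₀ refl
                          (J ∷ A ∷ S ∷ []) (⊆⇒─≡⊥ J⊆ , tt)
    A₀⊆A : A₀ ⊆ A
    A₀⊆A = ⊆-trans A₀⊆A∩S (p∩q⊆p A S)
    A₀⊆S : A₀ ⊆ S
    A₀⊆S = ⊆-trans A₀⊆A A⊆S
    indep : r A₀ ≡ ∣ A₀ ∣
    indep = trans (cong r (sym (in-A∩S A₀⊆A∩S))) rA₀
    no-raise : ∀ w → w ∈ A ─ A₀ → r (A₀ ∪ ⁅ w ⁆) ≤ r A₀
    no-raise w w∈ with r (A₀ ∪ ⁅ w ⁆) ≤? r A₀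
    ... | yes le = le
    ... | no raises = ⊥-elim (∈─⇒∉ A A₀ w∈ (subst (w ∈_) A₀+w≡A₀ (q⊆p∪q A₀ ⁅ w ⁆ (x∈⁅x⁆ w))))
      where
      w∈A : w ∈ A
      w∈A = p─q⊆p A A₀ w∈
      A₀+w⊆ : A₀ ∪ ⁅ w ⁆ ⊆ A ∩ S
      A₀+w⊆ = ∪-least A₀⊆A∩S (⁅⁆-⊆ (x∈p∩q⁺ (w∈A , A⊆S w∈A)))
      A₀+w≡A₀ : A₀ ∪ ⁅ w ⁆ ≡ A₀
      A₀+w≡A₀ = maximal (A₀ ∪ ⁅ w ⁆) (p⊆p∪q ⁅ w ⁆)
        (A₀+w⊆ , trans (cong r (in-A∩S A₀+w⊆))
                       (augment A₀ w A₀⊆S (A⊆S w∈A) (∈─⇒∉ A A₀ w∈) indep raises))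
    spans : r A ≤ r A₀
    spans = ≤-trans (≤-reflexive (cong r (sound ((v₀ ─ₑ v₁) ∷ []) v₁ (v₀ ∪ₑ (v₁ ─ₑ v₀)) refl
                                                 (A₀ ∷ A ∷ []) (⊆⇒─≡⊥ A₀⊆A , tt))))
                    (absorbs A₀ (A ─ A₀) A₀⊆S (⊆-trans (p─q⊆p A A₀) A⊆S) no-raise)

∸-preserves-+≤ : ∀ {a b d e c} → c ≤ a → c ≤ b → c ≤ d → c ≤ e → a + b ≤ d + e →
                 (a ∸ c) + (b ∸ c) ≤ (d ∸ c) + (e ∸ c)
∸-preserves-+≤ {a} {b} {d} {e} {c} c≤a c≤b c≤d c≤e a+b≤d+e =
  +-cancelʳ-≤ (c + c) _ _ (≤-trans (≤-reflexive (restore a b c≤a c≤b))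
                          (≤-trans a+b≤d+e (≤-reflexive (sym (restore d e c≤d c≤e)))))
  where
  regroup : ∀ x y c → x + y + (c + c) ≡ (x + c) + (y + c)
  regroup = solve-∀
  restore : ∀ x y → c ≤ x → c ≤ y → (x ∸ c) + (y ∸ c) + (c + c) ≡ x + y
  restore x y c≤x c≤y = trans (regroup (x ∸ c) (y ∸ c) c) (cong₂ _+_ (m∸n+n≡m c≤x) (m∸n+n≡m c≤y))

module Minors {n} (M : RankData n) (isM : IsMatroid M) where
  open IsMatroid isM
  open RankFacts M isM
  private
    r : Subset n → ℕ
    r = rk M
    S : Subset n
    S = E M

  deletion-isMatroid : ∀ X → IsMatroid (del M X)
  deletion-isMatroid X = record { R1 = r1 ; R2 = r2 ; R3 = r3 }
    where
    E' : Subset n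
    E' = S ─ X
    in-S : ∀ Y → Y ∩ E' ⊆ S
    in-S Y = ⊆-trans (p∩q⊆q Y E') (p─q⊆p S X)
    r1 : ∀ Y → Y ⊆ E' → r (Y ∩ E') ≤ ∣ Y ∣
    r1 Y _ = ≤-trans (R1 _ (in-S Y)) (p⊆q⇒∣p∣≤∣q∣ (p∩q⊆p Y E'))
    r2 : ∀ Y Z → Y ⊆ Z → Z ⊆ E' → r (Y ∩ E') ≤ r (Z ∩ E')
    r2 Y Z Y⊆Z _ = R2 _ _ (─≡⊥⇒⊆ (sound ((v₀ ─ₑ v₁) ∷ []) ((v₀ ∩ₑ v₂) ─ₑ (v₁ ∩ₑ v₂)) ∅ₑ refl
                                        (Y ∷ Z ∷ E' ∷ []) (⊆⇒─≡⊥ Y⊆Z , tt))) (in-S Z)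
    r3 : ∀ Y Z → Y ⊆ E' → Z ⊆ E' → r ((Y ∪ Z) ∩ E') + r ((Y ∩ Z) ∩ E') ≤ r (Y ∩ E') + r (Z ∩ E')
    r3 Y Z _ _ = ≤-trans (≤-reflexive (cong₂ (λ x y → r x + r y)
                   (sound [] ((v₀ ∪ₑ v₁) ∩ₑ v₂) ((v₀ ∩ₑ v₂) ∪ₑ (v₁ ∩ₑ v₂)) refl ρ tt)
                   (sound [] ((v₀ ∩ₑ v₁) ∩ₑ v₂) ((v₀ ∩ₑ v₂) ∩ₑ (v₁ ∩ₑ v₂)) refl ρ tt)))
                 (R3 _ _ (in-S Y) (in-S Z))
      where ρ = Y ∷ Z ∷ E' ∷ []

  contraction-isMatroid : ∀ X → IsMatroid (con M X)
  contraction-isMatroid X = record { R1 = r1 ; R2 = r2 ; R3 = r3 }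
    where
    E' : Subset n
    E' = S ─ X
    C : Subset n
    C  = X ∩ S
    C⊆S : C ⊆ S
    C⊆S = p∩q⊆q X S
    in-S : ∀ Y → Y ∩ E' ⊆ S
    in-S Y = ⊆-trans (p∩q⊆q Y E') (p─q⊆p S X)
    f : Subset n → ℕ
    f Y = r ((Y ∩ E') ∪ C)
    f⊆S : ∀ Y → (Y ∩ E') ∪ C ⊆ S
    f⊆S Y = ∪-least (in-S Y) C⊆S
    rC≤f : ∀ Y → r C ≤ f Y
    rC≤f Y = rank-mono (q⊆p∪q (Y ∩ E') C) (f⊆S Y)
    r1 : ∀ Y → Y ⊆ E' → f Y ∸ r C ≤ ∣ Y ∣
    r1 Y _ = ≤-trans (∸-monoˡ-≤ (r C) (≤-trans (rank-∪≤ (Y ∩ E') C (in-S Y) C⊆S)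
                       (+-monoˡ-≤ (r C) (≤-trans (R1 _ (in-S Y)) (p⊆q⇒∣p∣≤∣q∣ (p∩q⊆p Y E'))))))
                     (≤-reflexive (m+n∸n≡m ∣ Y ∣ (r C)))
    r2 : ∀ Y Z → Y ⊆ Z → Z ⊆ E' → f Y ∸ r C ≤ f Z ∸ r C
    r2 Y Z Y⊆Z _ = ∸-monoˡ-≤ (r C) (R2 _ _
      (─≡⊥⇒⊆ (sound ((v₀ ─ₑ v₁) ∷ []) (((v₀ ∩ₑ v₂) ∪ₑ v₃) ─ₑ ((v₁ ∩ₑ v₂) ∪ₑ v₃)) ∅ₑ refl
                    (Y ∷ Z ∷ E' ∷ C ∷ []) (⊆⇒─≡⊥ Y⊆Z , tt))) (f⊆S Z))
    r3 : ∀ Y Z → Y ⊆ E' → Z ⊆ E' →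
         (f (Y ∪ Z) ∸ r C) + (f (Y ∩ Z) ∸ r C) ≤ (f Y ∸ r C) + (f Z ∸ r C)
    r3 Y Z _ _ = ∸-preserves-+≤ (rC≤f (Y ∪ Z)) (rC≤f (Y ∩ Z)) (rC≤f Y) (rC≤f Z)
      (≤-trans (≤-reflexive (cong₂ (λ x y → r x + r y)
         (sound [] (((v₀ ∪ₑ v₁) ∩ₑ v₂) ∪ₑ v₃) (((v₀ ∩ₑ v₂) ∪ₑ v₃) ∪ₑ ((v₁ ∩ₑ v₂) ∪ₑ v₃)) refl ρ tt)
         (sound [] (((v₀ ∩ₑ v₁) ∩ₑ v₂) ∪ₑ v₃) (((v₀ ∩ₑ v₂) ∪ₑ v₃) ∩ₑ ((v₁ ∩ₑ v₂) ∪ₑ v₃)) refl ρ tt)))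
       (R3 _ _ (f⊆S Y) (f⊆S Z)))
      where ρ = Y ∷ Z ∷ E' ∷ C ∷ []

  -- r S ≤ |Y ∩ S| + r (S ─ Y): the dual rank is a well-defined difference.
  rank-S≤ : ∀ Y → r S ≤ ∣ Y ∩ S ∣ + r (S ─ Y)
  rank-S≤ Y = begin
    r S                        ≡⟨ cong r (sound [] v₁ ((v₁ ─ₑ v₀) ∪ₑ (v₀ ∩ₑ v₁)) refl (Y ∷ S ∷ []) tt) ⟩
    r ((S ─ Y) ∪ (Y ∩ S))      ≤⟨ rank-∪≤ (S ─ Y) (Y ∩ S) (p─q⊆p S Y) (p∩q⊆q Y S) ⟩
    r (S ─ Y) + r (Y ∩ S)      ≤⟨ +-monoʳ-≤ (r (S ─ Y)) (R1 _ (p∩q⊆q Y S)) ⟩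
    r (S ─ Y) + ∣ Y ∩ S ∣      ≡⟨ +-comm (r (S ─ Y)) ∣ Y ∩ S ∣ ⟩
    ∣ Y ∩ S ∣ + r (S ─ Y)      ∎
    where open ≤-Reasoning

  dual-isMatroid : IsMatroid (dual M)
  dual-isMatroid = record { R1 = r1 ; R2 = r2 ; R3 = r3 }
    where
    g : Subset n → ℕ
    g Y = ∣ Y ∩ S ∣ + r (S ─ Y)
    r1 : ∀ Y → Y ⊆ S → g Y ∸ r S ≤ ∣ Y ∣
    r1 Y _ = ≤-trans (∸-monoˡ-≤ (r S) (+-mono-≤ (p⊆q⇒∣p∣≤∣q∣ (p∩q⊆p Y S)) (rank-mono (p─q⊆p S Y) ⊆-refl)))
                     (≤-reflexive (m+n∸n≡m ∣ Y ∣ (r S)))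
    r2 : ∀ Y Z → Y ⊆ Z → Z ⊆ S → g Y ∸ r S ≤ g Z ∸ r S
    r2 Y Z Y⊆Z Z⊆S = ∸-monoˡ-≤ (r S) (begin
        ∣ Y ∩ S ∣ + r (S ─ Y)                     ≡⟨ cong₂ (λ x y → ∣ x ∣ + r y) (by (v₀ ∩ₑ v₂) v₀ refl)
                                                      (by (v₂ ─ₑ v₀) ((v₂ ─ₑ v₁) ∪ₑ (v₁ ─ₑ v₀)) refl) ⟩
        ∣ Y ∣ + r ((S ─ Z) ∪ (Z ─ Y))             ≤⟨ +-monoʳ-≤ ∣ Y ∣ (rank-∪≤ _ _ (p─q⊆p S Z) Z─Y⊆S) ⟩
        ∣ Y ∣ + (r (S ─ Z) + r (Z ─ Y))           ≤⟨ +-monoʳ-≤ ∣ Y ∣ (+-monoʳ-≤ (r (S ─ Z)) (R1 _ Z─Y⊆S)) ⟩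
        ∣ Y ∣ + (r (S ─ Z) + ∣ Z ─ Y ∣)           ≡⟨ regroup (∣ Y ∣) (r (S ─ Z)) (∣ Z ─ Y ∣) ⟩
        ∣ Y ∣ + ∣ Z ─ Y ∣ + r (S ─ Z)             ≡⟨ cong (λ x → ∣ x ∣ + ∣ Z ─ Y ∣ + r (S ─ Z))
                                                      (sym (by (v₁ ∩ₑ v₀) v₀ refl)) ⟩
        ∣ Z ∩ Y ∣ + ∣ Z ─ Y ∣ + r (S ─ Z)         ≡⟨ cong (_+ r (S ─ Z)) (sym (∣∩∣+∣─∣ Z Y)) ⟩
        ∣ Z ∣ + r (S ─ Z)                         ≡⟨ cong (λ x → ∣ x ∣ + r (S ─ Z)) (sym (by (v₁ ∩ₑ v₂) v₁ refl)) ⟩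
        ∣ Z ∩ S ∣ + r (S ─ Z)                     ∎)
      where
      open ≤-Reasoning
      hs : List (SetExpr 3)
      hs = (v₀ ─ₑ v₁) ∷ (v₁ ─ₑ v₂) ∷ []
      ρ = Y ∷ Z ∷ S ∷ []
      by : (a b : SetExpr 3) → valid 3 hs a b ≡ true → ⟦ a ⟧ ρ ≡ ⟦ b ⟧ ρ
      by a b ok = sound hs a b ok ρ (⊆⇒─≡⊥ Y⊆Z , ⊆⇒─≡⊥ Z⊆S , tt)
      Z─Y⊆S : Z ─ Y ⊆ S
      Z─Y⊆S = ⊆-trans (p─q⊆p Z Y) Z⊆S
      regroup : ∀ a b c → a + (b + c) ≡ a + c + b
      regroup = solve-∀
    r3 : ∀ Y Z → Y ⊆ S → Z ⊆ S → (g (Y ∪ Z) ∸ r S) + (g (Y ∩ Z) ∸ r S) ≤ (g Y ∸ r S) + (g Z ∸ r S)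
    r3 Y Z _ _ = ∸-preserves-+≤ (rank-S≤ (Y ∪ Z)) (rank-S≤ (Y ∩ Z)) (rank-S≤ Y) (rank-S≤ Z) (begin
        g (Y ∪ Z) + g (Y ∩ Z)
          ≡⟨ regroup₁ (∣ (Y ∪ Z) ∩ S ∣) (r (S ─ (Y ∪ Z))) (∣ (Y ∩ Z) ∩ S ∣) (r (S ─ (Y ∩ Z))) ⟩
        (∣ (Y ∪ Z) ∩ S ∣ + ∣ (Y ∩ Z) ∩ S ∣) + (r (S ─ (Y ∩ Z)) + r (S ─ (Y ∪ Z)))
          ≤⟨ +-mono-≤ (≤-reflexive sizes) ranks ⟩
        (∣ Y ∩ S ∣ + ∣ Z ∩ S ∣) + (r (S ─ Y) + r (S ─ Z))
          ≡⟨ regroup₂ (∣ Y ∩ S ∣) (∣ Z ∩ S ∣) (r (S ─ Y)) (r (S ─ Z)) ⟩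
        g Y + g Z ∎)
      where
      open ≤-Reasoning
      ρ = Y ∷ Z ∷ S ∷ []
      regroup₁ : ∀ a b c d → a + b + (c + d) ≡ (a + c) + (d + b)
      regroup₁ = solve-∀
      regroup₂ : ∀ a b c d → (a + b) + (c + d) ≡ (a + c) + (b + d)
      regroup₂ = solve-∀
      sizes : ∣ (Y ∪ Z) ∩ S ∣ + ∣ (Y ∩ Z) ∩ S ∣ ≡ ∣ Y ∩ S ∣ + ∣ Z ∩ S ∣
      sizes = trans (cong₂ (λ x y → ∣ x ∣ + ∣ y ∣)
                       (sound [] ((v₀ ∪ₑ v₁) ∩ₑ v₂) ((v₀ ∩ₑ v₂) ∪ₑ (v₁ ∩ₑ v₂)) refl ρ tt)
                       (sound [] ((v₀ ∩ₑ v₁) ∩ₑ v₂) ((v₀ ∩ₑ v₂) ∩ₑ (v₁ ∩ₑ v₂)) refl ρ tt))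
                    (∣∪∣+∣∩∣ (Y ∩ S) (Z ∩ S))
      ranks : r (S ─ (Y ∩ Z)) + r (S ─ (Y ∪ Z)) ≤ r (S ─ Y) + r (S ─ Z)
      ranks = ≤-trans (≤-reflexive (cong₂ (λ x y → r x + r y)
                         (sound [] (v₂ ─ₑ (v₀ ∩ₑ v₁)) ((v₂ ─ₑ v₀) ∪ₑ (v₂ ─ₑ v₁)) refl ρ tt)
                         (sound [] (v₂ ─ₑ (v₀ ∪ₑ v₁)) ((v₂ ─ₑ v₀) ∩ₑ (v₂ ─ₑ v₁)) refl ρ tt)))
                      (R3 _ _ (p─q⊆p S Y) (p─q⊆p S Z))

  free-over-complement : ∀ B B₀ X → B ⊆ S → IsBasis (restrict (dual M) B) B₀ →
    X ⊆ B → X ∩ B₀ ≡ ⊥ → ∣ X ∣ + r (S ─ B) ≤ r ((S ─ B) ∪ X)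
  free-over-complement B B₀ X B⊆S basis X⊆B X∩B₀≡⊥ = +-cancelʳ-≤ (∣ B₀ ∣ + ∣ R ∣) _ _ (begin
      ∣ X ∣ + r Q + (∣ B₀ ∣ + ∣ R ∣)  ≡⟨ regroup₁ (∣ B₀ ∣) (∣ X ∣) (∣ R ∣) (r Q) ⟩
      ∣ B₀ ∣ + ∣ X ∣ + ∣ R ∣ + r Q    ≡⟨ cong (_+ r Q) (sym size-B) ⟩
      ∣ B ∣ + r Q                     ≤⟨ B-vs-B₀ ⟩
      ∣ B₀ ∣ + r S                    ≤⟨ +-monoʳ-≤ ∣ B₀ ∣ rS≤ ⟩
      ∣ B₀ ∣ + (r (Q ∪ X) + ∣ R ∣)    ≡⟨ regroup₂ (∣ B₀ ∣) (r (Q ∪ X)) (∣ R ∣) ⟩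
      r (Q ∪ X) + (∣ B₀ ∣ + ∣ R ∣)    ∎)
    where
    open ≤-Reasoning
    Q : Subset n
    Q = S ─ B
    R : Subset n
    R = (B ─ B₀) ─ X
    d : Subset n → ℕ
    d Y = (∣ Y ∩ S ∣ + r (S ─ Y)) ∸ r S
    B₀-facts = RankFacts.restriction-basis (dual M) dual-isMatroid B B₀ B⊆S basis
    B₀⊆B : B₀ ⊆ B
    B₀⊆B = proj₁ B₀-facts
    dB₀ : d B₀ ≡ ∣ B₀ ∣
    dB₀ = proj₁ (proj₂ B₀-facts)
    dB≤dB₀ : d B ≤ d B₀
    dB≤dB₀ = proj₂ (proj₂ B₀-facts)
    hs : List (SetExpr 4)
    hs = (v₀ ─ₑ v₂) ∷ (v₂ ─ₑ v₁) ∷ (v₃ ─ₑ v₂) ∷ (v₀ ∩ₑ v₃) ∷ []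
    ρ = X ∷ S ∷ B ∷ B₀ ∷ []
    by : (a b : SetExpr 4) → valid 4 hs a b ≡ true → ⟦ a ⟧ ρ ≡ ⟦ b ⟧ ρ
    by a b ok = sound hs a b ok ρ (⊆⇒─≡⊥ X⊆B , ⊆⇒─≡⊥ B⊆S , ⊆⇒─≡⊥ B₀⊆B , X∩B₀≡⊥ , tt)
    regroup₁ : ∀ b₀ x r q → x + q + (b₀ + r) ≡ b₀ + x + r + q
    regroup₁ = solve-∀
    regroup₂ : ∀ b₀ u r → b₀ + (u + r) ≡ u + (b₀ + r)
    regroup₂ = solve-∀
    -- B₀ is dually spanning in B ...
    B-vs-B₀ : ∣ B ∣ + r Q ≤ ∣ B₀ ∣ + r S
    B-vs-B₀ = begin
      ∣ B ∣ + r Q                        ≡⟨ cong (λ x → ∣ x ∣ + r Q) (sym (by (v₂ ∩ₑ v₁) v₂ refl)) ⟩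
      ∣ B ∩ S ∣ + r Q                    ≡⟨ sym (m∸n+n≡m (rank-S≤ B)) ⟩
      d B + r S                          ≤⟨ +-monoˡ-≤ (r S) (≤-trans dB≤dB₀ (≤-reflexive dB₀)) ⟩
      ∣ B₀ ∣ + r S                       ∎
    -- ... and dually independent, so S ─ B₀ spans M
    rS≤rS─B₀ : r S ≤ r (S ─ B₀)
    rS≤rS─B₀ = +-cancelˡ-≤ ∣ B₀ ∣ _ _ (begin
      ∣ B₀ ∣ + r S                       ≡⟨ cong (_+ r S) (sym dB₀) ⟩
      d B₀ + r S                         ≡⟨ m∸n+n≡m (rank-S≤ B₀) ⟩
      ∣ B₀ ∩ S ∣ + r (S ─ B₀)            ≡⟨ cong (λ x → ∣ x ∣ + r (S ─ B₀)) (by (v₃ ∩ₑ v₁) v₃ refl) ⟩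
      ∣ B₀ ∣ + r (S ─ B₀)                ∎)
    Q∪X⊆S : Q ∪ X ⊆ S
    Q∪X⊆S = ∪-least (p─q⊆p S B) (⊆-trans X⊆B B⊆S)
    R⊆S : R ⊆ S
    R⊆S = ⊆-trans (p─q⊆p _ X) (⊆-trans (p─q⊆p B B₀) B⊆S)
    rS≤ : r S ≤ r (Q ∪ X) + ∣ R ∣
    rS≤ = begin
      r S                                ≤⟨ rS≤rS─B₀ ⟩
      r (S ─ B₀)                         ≡⟨ cong r (by (v₁ ─ₑ v₃) (((v₁ ─ₑ v₂) ∪ₑ v₀) ∪ₑ ((v₂ ─ₑ v₃) ─ₑ v₀)) refl) ⟩
      r ((Q ∪ X) ∪ R)                    ≤⟨ rank-∪≤ (Q ∪ X) R Q∪X⊆S R⊆S ⟩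
      r (Q ∪ X) + r R                    ≤⟨ +-monoʳ-≤ (r (Q ∪ X)) (R1 R R⊆S) ⟩
      r (Q ∪ X) + ∣ R ∣                  ∎
    size-B : ∣ B ∣ ≡ ∣ B₀ ∣ + ∣ X ∣ + ∣ R ∣
    size-B = begin-equality
      ∣ B ∣                              ≡⟨ ∣∩∣+∣─∣ B B₀ ⟩
      ∣ B ∩ B₀ ∣ + ∣ B ─ B₀ ∣            ≡⟨ cong₂ (λ x y → ∣ x ∣ + ∣ y ∣) (by (v₂ ∩ₑ v₃) v₃ refl)
                                              (by (v₂ ─ₑ v₃) (v₀ ∪ₑ ((v₂ ─ₑ v₃) ─ₑ v₀)) refl) ⟩
      ∣ B₀ ∣ + ∣ X ∪ R ∣                 ≡⟨ cong (∣ B₀ ∣ +_) (∣∪∣-disjoint X R (by (v₀ ∩ₑ ((v₂ ─ₑ v₃) ─ₑ v₀)) ∅ₑ refl)) ⟩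
      ∣ B₀ ∣ + (∣ X ∣ + ∣ R ∣)           ≡⟨ sym (+-assoc (∣ B₀ ∣) (∣ X ∣) (∣ R ∣)) ⟩
      ∣ B₀ ∣ + ∣ X ∣ + ∣ R ∣             ∎

  rank-avoiding-cobasis : ∀ B B₀ → B ⊆ S → IsBasis (restrict (dual M) B) B₀ →
    ∀ W → W ⊆ S → W ∩ B₀ ≡ ⊥ → r W ≡ r (W ─ B) + ∣ W ∩ B ∣
  rank-avoiding-cobasis B B₀ B⊆S basis W W⊆S W∩B₀≡⊥ = ≤-antisym upper (+-cancelʳ-≤ (r Q) _ _ lower)
    where
    open ≤-Reasoning
    Q : Subset n
    Q = S ─ B
    ρ = W ∷ S ∷ B ∷ []
    W─B⊆S : W ─ B ⊆ S
    W─B⊆S = ⊆-trans (p─q⊆p W B) W⊆S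
    W∩B⊆S : W ∩ B ⊆ S
    W∩B⊆S = ⊆-trans (p∩q⊆p W B) W⊆S
    upper : r W ≤ r (W ─ B) + ∣ W ∩ B ∣
    upper = begin
      r W                         ≡⟨ cong r (sound [] v₀ ((v₀ ─ₑ v₂) ∪ₑ (v₀ ∩ₑ v₂)) refl ρ tt) ⟩
      r ((W ─ B) ∪ (W ∩ B))       ≤⟨ rank-∪≤ (W ─ B) (W ∩ B) W─B⊆S W∩B⊆S ⟩
      r (W ─ B) + r (W ∩ B)       ≤⟨ +-monoʳ-≤ (r (W ─ B)) (R1 (W ∩ B) W∩B⊆S) ⟩
      r (W ─ B) + ∣ W ∩ B ∣       ∎
    W∩B∩B₀≡⊥ : (W ∩ B) ∩ B₀ ≡ ⊥
    W∩B∩B₀≡⊥ = sound ((v₀ ∩ₑ v₃) ∷ []) ((v₀ ∩ₑ v₂) ∩ₑ v₃) ∅ₑ refl (W ∷ S ∷ B ∷ B₀ ∷ []) (W∩B₀≡⊥ , tt)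
    regroup : ∀ a b c → a + b + c ≡ b + c + a
    regroup = solve-∀
    lower : r (W ─ B) + ∣ W ∩ B ∣ + r Q ≤ r W + r Q
    lower = begin
      r (W ─ B) + ∣ W ∩ B ∣ + r Q                 ≡⟨ regroup (r (W ─ B)) (∣ W ∩ B ∣) (r Q) ⟩
      ∣ W ∩ B ∣ + r Q + r (W ─ B)                 ≤⟨ +-monoˡ-≤ (r (W ─ B))
                                                       (free-over-complement B B₀ (W ∩ B) B⊆S basis
                                                          (p∩q⊆q W B) W∩B∩B₀≡⊥) ⟩
      r (Q ∪ (W ∩ B)) + r (W ─ B)                 ≡⟨ cong₂ (λ x y → r x + r y)
           (sound ((v₀ ─ₑ v₁) ∷ []) ((v₁ ─ₑ v₂) ∪ₑ (v₀ ∩ₑ v₂)) (v₀ ∪ₑ (v₁ ─ₑ v₂)) refl ρ (⊆⇒─≡⊥ W⊆S , tt))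
           (sound ((v₀ ─ₑ v₁) ∷ []) (v₀ ─ₑ v₂) (v₀ ∩ₑ (v₁ ─ₑ v₂)) refl ρ (⊆⇒─≡⊥ W⊆S , tt)) ⟩
      r (W ∪ Q) + r (W ∩ Q)                       ≤⟨ R3 W Q W⊆S (p─q⊆p S B) ⟩
      r W + r Q                                   ∎

maxList-≤ : ∀ {l u} → All (_≤ u) l → maxList l ≤ u
maxList-≤ All.[]         = z≤n
maxList-≤ (x≤u All.∷ xs) = ⊔-lub x≤u (maxList-≤ xs)

∈⇒≤maxList : ∀ {x l} → x ∈ˡ l → x ≤ maxList l
∈⇒≤maxList {l = y List.∷ l} (Any.here refl) = m≤m⊔n y (maxList l)
∈⇒≤maxList {l = y List.∷ l} (Any.there x∈) = ≤-trans (∈⇒≤maxList x∈) (m≤n⊔m y (maxList l))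

allSubsets-complete : ∀ {n} (p : Subset n) → p ∈ˡ allSubsets n
allSubsets-complete [] = Any.here refl
allSubsets-complete {suc n} (false ∷ p) = ∈-++⁺ˡ (∈-map⁺ (outside ∷_) (allSubsets-complete p))
allSubsets-complete {suc n} (true ∷ p) =
  ∈-++⁺ʳ (L.map (outside ∷_) (allSubsets n)) (∈-map⁺ (inside ∷_) (allSubsets-complete p))

Admissible : ∀ {n} → RankData n → RankData n → Subset n → Subset n → Subset n → Set
Admissible G H Z I₁ I₂ = (I₁ ⊆ Z ∩ E G) × (I₂ ⊆ Z ∩ E G) × Indep G I₁ × Indep H I₂

admissible? : ∀ {n} → RankData n → RankData n → Subset n → Subset n → Subset n → Bool
admissible? G H Z I₁ I₂ = does (I₁ ⊆? (Z ∩ E G)) ∧ does (I₂ ⊆? (Z ∩ E G)) ∧ indep? G I₁ ∧ indep? H I₂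

does⇒ : ∀ {P : Set} (d : Dec P) → does d ≡ true → P
does⇒ (yes p) _ = p

admissible-sound : ∀ {n} (G H : RankData n) Z I₁ I₂ →
  admissible? G H Z I₁ I₂ ≡ true → Admissible G H Z I₁ I₂
admissible-sound G H Z I₁ I₂ ok =
    does⇒ (I₁ ⊆? (Z ∩ E G)) (∧-true₁ ok)
  , does⇒ (I₂ ⊆? (Z ∩ E G)) (∧-true₁ ok₂)
  , (does⇒ (I₁ ⊆? E G) (∧-true₁ ok₃) , does⇒ (rk G I₁ Nat.≟ ∣ I₁ ∣) (∧-true₂ {does (I₁ ⊆? E G)} ok₃))
  , (does⇒ (I₂ ⊆? E H) (∧-true₁ ok₄) , does⇒ (rk H I₂ Nat.≟ ∣ I₂ ∣) (∧-true₂ {does (I₂ ⊆? E H)} ok₄))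
  where
  ok₂ : (does (I₂ ⊆? (Z ∩ E G)) ∧ indep? G I₁ ∧ indep? H I₂) ≡ true
  ok₂ = ∧-true₂ {does (I₁ ⊆? (Z ∩ E G))} ok
  ok₂₃ : (indep? G I₁ ∧ indep? H I₂) ≡ true
  ok₂₃ = ∧-true₂ {does (I₂ ⊆? (Z ∩ E G))} ok₂
  ok₃ : indep? G I₁ ≡ true
  ok₃ = ∧-true₁ ok₂₃
  ok₄ : indep? H I₂ ≡ true
  ok₄ = ∧-true₂ {indep? G I₁} ok₂₃

admissible-complete : ∀ {n} (G H : RankData n) Z I₁ I₂ →
  Admissible G H Z I₁ I₂ → admissible? G H Z I₁ I₂ ≡ true
admissible-complete G H Z I₁ I₂ (p₁ , p₂ , (p₃ , p₄) , (p₅ , p₆))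
  rewrite dec-true (I₁ ⊆? (Z ∩ E G)) p₁ | dec-true (I₂ ⊆? (Z ∩ E G)) p₂
        | dec-true (I₁ ⊆? E G) p₃ | dec-true (rk G I₁ Nat.≟ ∣ I₁ ∣) p₄
        | dec-true (I₂ ⊆? E H) p₅ | dec-true (rk H I₂ Nat.≟ ∣ I₂ ∣) p₆ = refl

pairTerm : ∀ {n} → RankData n → RankData n → Subset n → Subset n → Subset n → ℕ
pairTerm G H Z I₁ I₂ = if admissible? G H Z I₁ I₂ then ∣ I₁ ∪ I₂ ∣ else 0

pairTerm-≤ : ∀ {n} (G H : RankData n) Z I₁ I₂ {u} →
  (Admissible G H Z I₁ I₂ → ∣ I₁ ∪ I₂ ∣ ≤ u) → pairTerm G H Z I₁ I₂ ≤ u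
pairTerm-≤ G H Z I₁ I₂ bound with admissible? G H Z I₁ I₂ in ok
... | true  = bound (admissible-sound G H Z I₁ I₂ ok)
... | false = z≤n

union-rank-≤ : ∀ {n} (G H : RankData n) Z {u} →
  (∀ I₁ I₂ → Admissible G H Z I₁ I₂ → ∣ I₁ ∪ I₂ ∣ ≤ u) → rk (unionM G H) Z ≤ u
union-rank-≤ {n} G H Z bound = maxList-≤ (concat⁺ (map⁺ (universal
  (λ I₁ → map⁺ (universal (λ I₂ → pairTerm-≤ G H Z I₁ I₂ (bound I₁ I₂)) (allSubsets n)))
  (allSubsets n))))

≤-union-rank : ∀ {n} (G H : RankData n) Z I₁ I₂ →
  Admissible G H Z I₁ I₂ → ∣ I₁ ∪ I₂ ∣ ≤ rk (unionM G H) Z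
≤-union-rank {n} G H Z I₁ I₂ adm = ∈⇒≤maxList (subst (_∈ˡ _) value
  (∈-concatMap⁺ (λ I → L.map (pairTerm G H Z I) (allSubsets n))
    (Any.map (λ { refl → ∈-map⁺ (pairTerm G H Z I₁) (allSubsets-complete I₂) })
             (allSubsets-complete I₁))))
  where
  value : pairTerm G H Z I₁ I₂ ≡ ∣ I₁ ∪ I₂ ∣
  value rewrite admissible-complete G H Z I₁ I₂ adm = refl

psRank : ∀ {n} → RankData n → RankData n → Subset n → Subset n → Subset n → ℕ
psRank M N A B Z = (rk M ((Z ∩ E M) ∪ A) + rk N (Z ∩ E N))
                   ⊓ (rk M (Z ∩ E M) + rk N ((Z ∩ E N) ─ B) + ∣ (Z ∩ E N) ∩ B ∣)

loops-independent : ∀ {n} (N : RankData n) → IsMatroid N → ∀ S I →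
  rk (addLoops N S) I ≡ ∣ I ∣ → (I ⊆ E N) × (rk N I ≡ ∣ I ∣)
loops-independent {n} N isN S I rI = I⊆T , trans (cong (rk N) (sym I∩T≡I)) rI
  where
  T : Subset n
  T = E N
  I⊆I∩T : I ⊆ I ∩ T
  I⊆I∩T = ⊆-by-size (p∩q⊆p I T) (≤-trans (≤-reflexive (sym rI)) (IsMatroid.R1 isN (I ∩ T) (p∩q⊆q I T)))
  I⊆T : I ⊆ T
  I⊆T = ⊆-trans I⊆I∩T (p∩q⊆q I T)
  I∩T≡I : I ∩ T ≡ I
  I∩T≡I = sound ((v₀ ─ₑ v₁) ∷ []) (v₀ ∩ₑ v₁) v₀ refl (I ∷ T ∷ []) (⊆⇒─≡⊥ I⊆T , tt)

extension-independent : ∀ {n} (M : RankData n) → IsMatroid M → ∀ T A B I →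
  E M ∩ T ≡ ⊥ → I ⊆ E M ∪ T → rk (plusExt M T A B) I ≡ ∣ I ∣ →
  (∣ I ∣ ≤ rk M ((I ∩ E M) ∪ A)) × (rk M (I ∩ E M) ≡ ∣ I ∩ E M ∣) × (I ∩ T ⊆ B)
extension-independent {n} M isM T A B I S∩T≡⊥ I⊆S∪T rI =
  ≤-trans (≤-reflexive (sym rI)) (m⊓n≤m _ _) ,
  ≤-antisym rIS≤ (+-cancelʳ-≤ ∣ I ∩ T ∣ _ _ (≤-trans split-bound (+-monoʳ-≤ (rk M (I ∩ S)) |I∩T∩B|≤))) ,
  ⊆-trans (⊆-by-size (p∩q⊆p (I ∩ T) B) |I∩T|≤) (p∩q⊆q (I ∩ T) B)
  where
  S : Subset n
  S = E M
  rIS≤ : rk M (I ∩ S) ≤ ∣ I ∩ S ∣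
  rIS≤ = IsMatroid.R1 isM (I ∩ S) (p∩q⊆q I S)
  |I∩T∩B|≤ : ∣ (I ∩ T) ∩ B ∣ ≤ ∣ I ∩ T ∣
  |I∩T∩B|≤ = p⊆q⇒∣p∣≤∣q∣ (p∩q⊆p (I ∩ T) B)
  size : ∣ I ∣ ≡ ∣ I ∩ S ∣ + ∣ I ∩ T ∣
  size = trans (cong ∣_∣ (sound ((v₀ ─ₑ (v₁ ∪ₑ v₂)) ∷ []) v₀ ((v₀ ∩ₑ v₁) ∪ₑ (v₀ ∩ₑ v₂)) refl ρ (⊆⇒─≡⊥ I⊆S∪T , tt)))
               (∣∪∣-disjoint (I ∩ S) (I ∩ T) (sound ((v₁ ∩ₑ v₂) ∷ []) ((v₀ ∩ₑ v₁) ∩ₑ (v₀ ∩ₑ v₂)) ∅ₑ refl ρ (S∩T≡⊥ , tt)))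
    where ρ = I ∷ S ∷ T ∷ []
  -- the second term of the rank of M⁺ bounds the size of I
  split-bound : ∣ I ∩ S ∣ + ∣ I ∩ T ∣ ≤ rk M (I ∩ S) + ∣ (I ∩ T) ∩ B ∣
  split-bound = ≤-trans (≤-reflexive (trans (sym size) (sym rI))) (m⊓n≤n _ _)
  |I∩T|≤ : ∣ I ∩ T ∣ ≤ ∣ (I ∩ T) ∩ B ∣
  |I∩T|≤ = +-cancelˡ-≤ ∣ I ∩ S ∣ _ _ (≤-trans split-bound (+-monoˡ-≤ ∣ (I ∩ T) ∩ B ∣ rIS≤))

module PrincipalSumRank {n} (M N : RankData n) (isM : IsMatroid M) (isN : IsMatroid N)
                        (S∩T≡⊥ : E M ∩ E N ≡ ⊥) (A B : Subset n) (A⊆S : A ⊆ E M) where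
  private
    S : Subset n
    S = E M
    T : Subset n
    T = E N
    rM rN : Subset n → ℕ
    rM = rk M
    rN = rk N
    G H : RankData n
    G = plusExt M T A B
    H = addLoops N S
    module RM = RankFacts M isM
    module RN = RankFacts N isN

  pair-bound : ∀ Z I₁ I₂ → Admissible G H Z I₁ I₂ → ∣ I₁ ∪ I₂ ∣ ≤ psRank M N A B Z
  pair-bound Z I₁ I₂ (I₁⊆Z , I₂⊆Z , (I₁⊆S∪T , rI₁) , (_ , rI₂)) = ⊓-glb via-span via-B
    where
    zS zT : Subset n
    zS = Z ∩ S
    zT = Z ∩ T
    I₂-facts = loops-independent N isN S I₂ rI₂
    I₁-facts = extension-independent M isM T A B I₁ S∩T≡⊥ I₁⊆S∪T rI₁
    I₂⊆zT : I₂ ⊆ zT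
    I₂⊆zT x∈ = x∈p∩q⁺ (p∩q⊆p Z (S ∪ T) (I₂⊆Z x∈) , proj₁ I₂-facts x∈)
    hs : List (SetExpr 7)
    hs = (v₅ ─ₑ (v₀ ∩ₑ (v₁ ∪ₑ v₂))) ∷ (v₆ ─ₑ (v₀ ∩ₑ v₂)) ∷ ((v₅ ∩ₑ v₂) ─ₑ v₄) ∷ []
    ρ = Z ∷ S ∷ T ∷ A ∷ B ∷ I₁ ∷ I₂ ∷ []
    by-⊆ : (a b : SetExpr 7) → valid 7 hs (a ─ₑ b) ∅ₑ ≡ true → ⟦ a ⟧ ρ ⊆ ⟦ b ⟧ ρ
    by-⊆ a b ok = ─≡⊥⇒⊆ (sound hs (a ─ₑ b) ∅ₑ ok ρ
                          (⊆⇒─≡⊥ I₁⊆Z , ⊆⇒─≡⊥ I₂⊆zT , ⊆⇒─≡⊥ (proj₂ (proj₂ I₁-facts)) , tt))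
    -- I₁ is spanned by (Z_S ∪ A) in M and I₂ is independent in N|Z_T
    via-span : ∣ I₁ ∪ I₂ ∣ ≤ rM (zS ∪ A) + rN zT
    via-span = ≤-trans (∣∪∣≤ I₁ I₂) (+-mono-≤
      (≤-trans (proj₁ I₁-facts) (RM.rank-mono (by-⊆ ((v₅ ∩ₑ v₁) ∪ₑ v₃) ((v₀ ∩ₑ v₁) ∪ₑ v₃) refl)
                                              (∪-least (p∩q⊆q Z S) A⊆S)))
      (≤-trans (≤-reflexive (sym (proj₂ I₂-facts))) (RN.rank-mono I₂⊆zT (p∩q⊆q Z T))))
    -- I₁ ∩ S is independent in M|Z_S, I₁ ∩ T ⊆ Z_T ∩ B and I₂ ─ B is independent in N|(Z_T ─ B)
    via-B : ∣ I₁ ∪ I₂ ∣ ≤ rM zS + rN (zT ─ B) + ∣ zT ∩ B ∣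
    via-B = begin
      ∣ I₁ ∪ I₂ ∣
        ≤⟨ p⊆q⇒∣p∣≤∣q∣ (by-⊆ (v₅ ∪ₑ v₆) ((v₅ ∩ₑ v₁) ∪ₑ (((v₀ ∩ₑ v₂) ∩ₑ v₄) ∪ₑ (v₆ ─ₑ v₄))) refl) ⟩
      ∣ (I₁ ∩ S) ∪ ((zT ∩ B) ∪ (I₂ ─ B)) ∣
        ≤⟨ ≤-trans (∣∪∣≤ (I₁ ∩ S) _) (+-monoʳ-≤ ∣ I₁ ∩ S ∣ (∣∪∣≤ (zT ∩ B) (I₂ ─ B))) ⟩
      ∣ I₁ ∩ S ∣ + (∣ zT ∩ B ∣ + ∣ I₂ ─ B ∣)
        ≤⟨ +-mono-≤ part-S (+-monoʳ-≤ ∣ zT ∩ B ∣ part-T) ⟩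
      rM zS + (∣ zT ∩ B ∣ + rN (zT ─ B))
        ≡⟨ regroup (rM zS) (∣ zT ∩ B ∣) (rN (zT ─ B)) ⟩
      rM zS + rN (zT ─ B) + ∣ zT ∩ B ∣ ∎
      where
      open ≤-Reasoning
      regroup : ∀ a b c → a + (b + c) ≡ a + c + b
      regroup = solve-∀
      part-S : ∣ I₁ ∩ S ∣ ≤ rM zS
      part-S = ≤-trans (≤-reflexive (sym (proj₁ (proj₂ I₁-facts))))
                       (RM.rank-mono (by-⊆ (v₅ ∩ₑ v₁) (v₀ ∩ₑ v₁) refl) (p∩q⊆q Z S))
      part-T : ∣ I₂ ─ B ∣ ≤ rN (zT ─ B)
      part-T = ≤-trans (≤-reflexive (sym (RN.independent-⊆ (I₂ ─ B) I₂ (p─q⊆p I₂ B) (proj₁ I₂-facts) (proj₂ I₂-facts))))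
                       (RN.rank-mono (by-⊆ (v₆ ─ₑ v₄) ((v₀ ∩ₑ v₂) ─ₑ v₄) refl) (⊆-trans (p─q⊆p zT B) (p∩q⊆q Z T)))

  -- Take a basis
  -- I-S of Z_S in M, a basis I-T of Z_T in N extending a basis of Z_T ─ B, and
  -- add to I-S as many elements K of (Z_T ─ I-T) ∩ B as r_M(Z_S ∪ A) allows.
  module Witness (Z : Subset n) where
    zS zT : Subset n
    zS = Z ∩ S
    zT = Z ∩ T
    private
      basis-S   = RM.basis-of zS (p∩q⊆q Z S)
      basis-T─B = RN.basis-of (zT ─ B) (⊆-trans (p─q⊆p zT B) (p∩q⊆q Z T))
    J₀ : Subset n
    J₀ = proj₁ basis-T─B
    private
      spanning-T = RN.extend-to-spanning zT J₀ (p∩q⊆q Z T)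
                     (⊆-trans (proj₁ (proj₂ basis-T─B)) (p─q⊆p zT B)) (proj₁ (proj₂ (proj₂ basis-T─B)))
    I-S I-T : Subset n
    I-S = proj₁ basis-S
    I-T   = proj₁ spanning-T
    a c k : ℕ
    a = rM (zS ∪ A)
    c = rM zS
    D : Subset n
    D = (zT ─ I-T) ∩ B
    k = ∣ D ∣ ⊓ (a ∸ c)
    private
      chosen = subset-of-size D k (m⊓n≤m _ _)
    K I₁ : Subset n
    K  = proj₁ chosen
    I₁ = I-S ∪ K

    c≤a : c ≤ a
    c≤a = RM.rank-mono (p⊆p∪q A) (∪-least (p∩q⊆q Z S) A⊆S)
    rI-S : rM I-S ≡ ∣ I-S ∣
    rI-S = proj₁ (proj₂ (proj₂ basis-S))
    rI-S≡c : rM I-S ≡ c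
    rI-S≡c = proj₂ (proj₂ (proj₂ basis-S))
    rI-T : rN I-T ≡ ∣ I-T ∣
    rI-T = proj₁ (proj₂ (proj₂ (proj₂ spanning-T)))
    |K| : ∣ K ∣ ≡ k
    |K| = proj₂ (proj₂ chosen)

    private
      hs : List (SetExpr 8)
      hs = (v₁ ∩ₑ v₂) ∷ (v₅ ─ₑ (v₀ ∩ₑ v₁)) ∷ (v₆ ─ₑ (v₀ ∩ₑ v₂)) ∷ (v₇ ─ₑ (((v₀ ∩ₑ v₂) ─ₑ v₆) ∩ₑ v₄))
           ∷ (v₃ ─ₑ v₁) ∷ []
      ρ : Vec (Subset n) 8
      ρ = Z ∷ S ∷ T ∷ A ∷ B ∷ I-S ∷ I-T ∷ K ∷ []
      by : (a b : SetExpr 8) → valid 8 hs a b ≡ true → ⟦ a ⟧ ρ ≡ ⟦ b ⟧ ρ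
      by a b ok = sound hs a b ok ρ (S∩T≡⊥ , ⊆⇒─≡⊥ (proj₁ (proj₂ basis-S)) ,
                                     ⊆⇒─≡⊥ (proj₁ (proj₂ (proj₂ spanning-T))) , ⊆⇒─≡⊥ (proj₁ (proj₂ chosen)) ,
                                     ⊆⇒─≡⊥ A⊆S , tt)
      by-⊆ : (a b : SetExpr 8) → valid 8 hs (a ─ₑ b) ∅ₑ ≡ true → ⟦ a ⟧ ρ ⊆ ⟦ b ⟧ ρ
      by-⊆ a b ok = ─≡⊥⇒⊆ (by (a ─ₑ b) ∅ₑ ok)

    |I₁| : ∣ I₁ ∣ ≡ c + k
    |I₁| = trans (∣∪∣-disjoint I-S K (by (v₅ ∩ₑ v₇) ∅ₑ refl)) (cong₂ _+_ (trans (sym rI-S) rI-S≡c) |K|)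

    -- I₁ is independent in M⁺(A,B): I-S spans Z_S, and K fits below r_M(Z_S ∪ A).
    I₁-independent : rk G I₁ ≡ ∣ I₁ ∣
    I₁-independent = begin
      rM ((I₁ ∩ S) ∪ A) ⊓ (rM (I₁ ∩ S) + ∣ (I₁ ∩ T) ∩ B ∣)
        ≡⟨ cong₂ (λ x y → rM (x ∪ A) ⊓ (rM x + ∣ y ∣)) (by ((v₅ ∪ₑ v₇) ∩ₑ v₁) v₅ refl)
                                                       (by (((v₅ ∪ₑ v₇) ∩ₑ v₂) ∩ₑ v₄) v₇ refl) ⟩
      rM (I-S ∪ A) ⊓ (rM I-S + ∣ K ∣)
        ≡⟨ cong₂ (λ x y → x ⊓ (y + ∣ K ∣)) spans rI-S≡c ⟩
      a ⊓ (c + ∣ K ∣)  ≡⟨ cong (λ y → a ⊓ (c + y)) |K| ⟩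
      a ⊓ (c + k)      ≡⟨ m≥n⇒m⊓n≡n c+k≤a ⟩
      c + k            ≡⟨ sym |I₁| ⟩
      ∣ I₁ ∣           ∎
      where
      open ≡-Reasoning
      spans : rM (I-S ∪ A) ≡ a
      spans = trans (cong rM (∪-comm I-S A))
                (trans (sym (RM.span-∪ ⊆-refl (proj₁ (proj₂ basis-S)) (p∩q⊆q Z S)
                                       (≤-reflexive (sym rI-S≡c)) A⊆S))
                       (cong rM (∪-comm A zS)))
      c+k≤a : c + k ≤ a
      c+k≤a = ≤-trans (+-monoʳ-≤ c (m⊓n≤n ∣ D ∣ (a ∸ c))) (≤-reflexive (m+[n∸m]≡n c≤a))

    admissible : Admissible G H Z I₁ I-T
    admissible = by-⊆ (v₅ ∪ₑ v₇) (v₀ ∩ₑ (v₁ ∪ₑ v₂)) refl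
               , by-⊆ v₆ (v₀ ∩ₑ (v₁ ∪ₑ v₂)) refl
               , (by-⊆ (v₅ ∪ₑ v₇) (v₁ ∪ₑ v₂) refl , I₁-independent)
               , (by-⊆ v₆ (v₂ ∪ₑ v₁) refl , trans (cong rN (by (v₆ ∩ₑ v₂) v₆ refl)) rI-T)

    |I₁∪I-T| : ∣ I₁ ∪ I-T ∣ ≡ c + k + ∣ I-T ∣
    |I₁∪I-T| = trans (∣∪∣-disjoint I₁ I-T (by ((v₅ ∪ₑ v₇) ∩ₑ v₆) ∅ₑ refl)) (cong (_+ ∣ I-T ∣) |I₁|)

    -- Either K exhausts D, and then the B-term of psRank is attained, or K
    -- fills the rank r_M(Z_S ∪ A), and then the span term is.
    psRank≤ : psRank M N A B Z ≤ c + k + ∣ I-T ∣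
    psRank≤ with ∣ D ∣ ≤? (a ∸ c)
    ... | yes |D|≤ = ≤-trans (m⊓n≤n _ _) (begin
        c + rN (zT ─ B) + ∣ zT ∩ B ∣              ≤⟨ +-monoˡ-≤ ∣ zT ∩ B ∣ (+-monoʳ-≤ c rank-T─B≤) ⟩
        c + ∣ I-T ─ B ∣ + ∣ zT ∩ B ∣                ≡⟨ cong (c + ∣ I-T ─ B ∣ +_) |zT∩B| ⟩
        c + ∣ I-T ─ B ∣ + (∣ D ∣ + ∣ I-T ∩ B ∣)        ≡⟨ regroup c (∣ I-T ─ B ∣) (∣ D ∣) (∣ I-T ∩ B ∣) ⟩
        c + ∣ D ∣ + (∣ I-T ∩ B ∣ + ∣ I-T ─ B ∣)        ≡⟨ cong (c + ∣ D ∣ +_) (sym (∣∩∣+∣─∣ I-T B)) ⟩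
        c + ∣ D ∣ + ∣ I-T ∣                          ≡⟨ cong (λ y → c + y + ∣ I-T ∣) (sym (m≤n⇒m⊓n≡m |D|≤)) ⟩
        c + k + ∣ I-T ∣                              ∎)
      where
      open ≤-Reasoning
      regroup : ∀ c j d b → c + j + (d + b) ≡ c + d + (b + j)
      regroup = solve-∀
      J₀⊆I-T─B : J₀ ⊆ I-T ─ B
      J₀⊆I-T─B x∈ = x∈p∧x∉q⇒x∈p─q (proj₁ (proj₂ spanning-T) x∈)
                                (∈─⇒∉ zT B (proj₁ (proj₂ basis-T─B) x∈))
      rank-T─B≤ : rN (zT ─ B) ≤ ∣ I-T ─ B ∣
      rank-T─B≤ = ≤-trans (≤-reflexive (trans (sym (proj₂ (proj₂ (proj₂ basis-T─B))))
                                              (proj₁ (proj₂ (proj₂ basis-T─B)))))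
                          (p⊆q⇒∣p∣≤∣q∣ J₀⊆I-T─B)
      |zT∩B| : ∣ zT ∩ B ∣ ≡ ∣ D ∣ + ∣ I-T ∩ B ∣
      |zT∩B| = trans (cong ∣_∣ (by ((v₀ ∩ₑ v₂) ∩ₑ v₄) ((((v₀ ∩ₑ v₂) ─ₑ v₆) ∩ₑ v₄) ∪ₑ (v₆ ∩ₑ v₄)) refl))
                     (∣∪∣-disjoint D (I-T ∩ B) (by ((((v₀ ∩ₑ v₂) ─ₑ v₆) ∩ₑ v₄) ∩ₑ (v₆ ∩ₑ v₄)) ∅ₑ refl))
    ... | no |D|≰ = ≤-trans (m⊓n≤m _ _) (≤-reflexive (begin
        a + rN zT                    ≡⟨ cong₂ _+_ (sym (m+[n∸m]≡n c≤a))
                                        (trans (sym (proj₂ (proj₂ (proj₂ (proj₂ spanning-T))))) rI-T) ⟩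
        c + (a ∸ c) + ∣ I-T ∣          ≡⟨ cong (λ y → c + y + ∣ I-T ∣) (sym (m≥n⇒m⊓n≡n (<⇒≤ (≰⇒> |D|≰)))) ⟩
        c + k + ∣ I-T ∣                ∎))
      where open ≡-Reasoning

  principalSum-rank : ∀ Z → rk (principalSum M N A B) Z ≡ psRank M N A B Z
  principalSum-rank Z = ≤-antisym
    (union-rank-≤ G H Z (pair-bound Z))
    (≤-trans psRank≤ (≤-trans (≤-reflexive (sym |I₁∪I-T|)) (≤-union-rank G H Z I₁ I-T admissible)))
    where open Witness Z

∸-+-+ : ∀ {a b c d} e → c ≤ a → d ≤ b → (a + b + e) ∸ (c + d) ≡ (a ∸ c) + (b ∸ d) + e
∸-+-+ {a} {b} {c} {d} e c≤a d≤b = trans (cong (_∸ (c + d)) restore) (m+n∸n≡m _ (c + d))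
  where
  regroup : ∀ x y c d e → (x + c) + (y + d) + e ≡ (x + y + e) + (c + d)
  regroup = solve-∀
  restore : a + b + e ≡ (a ∸ c) + (b ∸ d) + e + (c + d)
  restore = trans (cong₂ (λ x y → x + y + e) (sym (m∸n+n≡m c≤a)) (sym (m∸n+n≡m d≤b)))
                  (regroup (a ∸ c) (b ∸ d) c d e)

∸-⊓-contract : ∀ {m₁ n₁ m₂ nWB zb xb mx nx nW} → mx ≤ m₁ → nx ≤ n₁ → mx ≤ m₂ → nx ≤ nW →
  nW ≡ nWB + xb →
  ((m₁ + n₁) ⊓ (m₂ + nWB + (zb + xb))) ∸ (mx + nx) ≡ ((m₁ ∸ mx) + (n₁ ∸ nx)) ⊓ ((m₂ ∸ mx) + (nW ∸ nx) + zb)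
∸-⊓-contract {m₁} {n₁} {m₂} {nWB} {zb} {xb} {mx} {nx} {nW} mx≤m₁ nx≤n₁ mx≤m₂ nx≤nW nW≡ = begin
  ((m₁ + n₁) ⊓ (m₂ + nWB + (zb + xb))) ∸ (mx + nx)
    ≡⟨ ∸-distribʳ-⊓ (mx + nx) (m₁ + n₁) (m₂ + nWB + (zb + xb)) ⟩
  ((m₁ + n₁) ∸ (mx + nx)) ⊓ ((m₂ + nWB + (zb + xb)) ∸ (mx + nx))
    ≡⟨ cong₂ _⊓_ first second ⟩
  ((m₁ ∸ mx) + (n₁ ∸ nx)) ⊓ ((m₂ ∸ mx) + (nW ∸ nx) + zb) ∎
  where
  open ≡-Reasoning
  regroup : ∀ m₂ nWB zb xb → m₂ + nWB + (zb + xb) ≡ m₂ + (nWB + xb) + zb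
  regroup = solve-∀
  first : (m₁ + n₁) ∸ (mx + nx) ≡ (m₁ ∸ mx) + (n₁ ∸ nx)
  first = trans (cong (_∸ (mx + nx)) (sym (+-identityʳ (m₁ + n₁))))
                (trans (∸-+-+ 0 mx≤m₁ nx≤n₁) (+-identityʳ _))
  second : (m₂ + nWB + (zb + xb)) ∸ (mx + nx) ≡ (m₂ ∸ mx) + (nW ∸ nx) + zb
  second = trans (cong (_∸ (mx + nx)) (trans (regroup m₂ nWB zb xb) (cong (λ w → m₂ + w + zb) (sym nW≡))))
                 (∸-+-+ zb mx≤m₂ nx≤nW)

module MinorSetting {n} (M N : RankData n) (isM : IsMatroid M) (isN : IsMatroid N)
                    (S∩T≡⊥ : E M ∩ E N ≡ ⊥) (A B : Subset n) (A⊆S : A ⊆ E M) where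
  S : Subset n
  S = E M
  T : Subset n
  T = E N

  ground : ∀ X → (S ∪ T) ─ X ≡ (S ─ (X ∩ S)) ∪ (T ─ (X ∩ T))
  ground X = sound [] ((v₁ ∪ₑ v₂) ─ₑ v₀) ((v₁ ─ₑ (v₀ ∩ₑ v₁)) ∪ₑ (v₂ ─ₑ (v₀ ∩ₑ v₂))) refl (X ∷ S ∷ T ∷ []) tt

  minors-disjoint : ∀ X → (S ─ (X ∩ S)) ∩ (T ─ (X ∩ T)) ≡ ⊥
  minors-disjoint X = sound ((v₁ ∩ₑ v₂) ∷ []) ((v₁ ─ₑ (v₀ ∩ₑ v₁)) ∩ₑ (v₂ ─ₑ (v₀ ∩ₑ v₂))) ∅ₑ refl
                            (X ∷ S ∷ T ∷ []) (S∩T≡⊥ , tt)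

  A─X⊆ : ∀ X → A ─ X ⊆ S ─ (X ∩ S)
  A─X⊆ X = ─≡⊥⇒⊆ (sound ((v₃ ─ₑ v₁) ∷ []) ((v₃ ─ₑ v₀) ─ₑ (v₁ ─ₑ (v₀ ∩ₑ v₁))) ∅ₑ refl
                         (X ∷ S ∷ T ∷ A ∷ []) (⊆⇒─≡⊥ A⊆S , tt))

  module P = PrincipalSumRank M N isM isN S∩T≡⊥ A B A⊆S

  module DeletionRanks (A₀ X : Subset n) (basis : IsBasis (restrict M A) A₀)
                       (X⊆ : X ⊆ ((S ─ A₀) ∪ T)) (Z : Subset n) (Z⊆ : Z ⊆ (S ∪ T) ─ X) where
    Z' : Subset n
    Z' = Z ∩ ((S ∪ T) ─ X)
    private
      A₀-facts = RankFacts.restriction-basis M isM A A₀ A⊆S basis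
      hs : List (SetExpr 7)
      hs = (v₀ ─ₑ ((v₂ ∪ₑ v₃) ─ₑ v₁)) ∷ (v₄ ─ₑ v₂) ∷ (v₂ ∩ₑ v₃) ∷ (v₁ ─ₑ ((v₂ ─ₑ v₆) ∪ₑ v₃)) ∷ (v₆ ─ₑ v₄) ∷ []
      ρ : Vec (Subset n) 7
      ρ = Z ∷ X ∷ S ∷ T ∷ A ∷ B ∷ A₀ ∷ []
      S' T' zS' zT' : SetExpr 7
      S' = v₂ ─ₑ (v₁ ∩ₑ v₂)
      T' = v₃ ─ₑ (v₁ ∩ₑ v₃)
      zS' = (v₀ ∩ₑ ((v₂ ∪ₑ v₃) ─ₑ v₁)) ∩ₑ v₂
      zT' = (v₀ ∩ₑ ((v₂ ∪ₑ v₃) ─ₑ v₁)) ∩ₑ v₃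
      by : (a b : SetExpr 7) → valid 7 hs a b ≡ true → ⟦ a ⟧ ρ ≡ ⟦ b ⟧ ρ
      by a b ok = sound hs a b ok ρ (⊆⇒─≡⊥ Z⊆ , ⊆⇒─≡⊥ A⊆S , S∩T≡⊥ , ⊆⇒─≡⊥ X⊆ , ⊆⇒─≡⊥ (proj₁ A₀-facts) , tt)

    -- A ─ X still contains the basis A₀, so it spans the same flat as A.
    span-term : rk M ((Z' ∩ S) ∪ A) ≡ rk M (((Z ∩ (S ─ (X ∩ S))) ∪ (A ─ X)) ∩ (S ─ (X ∩ S)))
    span-term = begin
      rk M ((Z' ∩ S) ∪ A)        ≡⟨ cong (rk M) (by (zS' ∪ₑ v₄) ((v₀ ∩ₑ v₂) ∪ₑ v₄) refl) ⟩
      rk M ((Z ∩ S) ∪ A)         ≡⟨ RankFacts.span-∪ M isM (─≡⊥⇒⊆ (by (v₆ ─ₑ (v₄ ─ₑ v₁)) ∅ₑ refl))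
                                      (p─q⊆p A X) A⊆S (proj₂ (proj₂ A₀-facts)) (p∩q⊆q Z S) ⟩
      rk M ((Z ∩ S) ∪ (A ─ X))   ≡⟨ cong (rk M) (by ((v₀ ∩ₑ v₂) ∪ₑ (v₄ ─ₑ v₁))
                                                    (((v₀ ∩ₑ S') ∪ₑ (v₄ ─ₑ v₁)) ∩ₑ S') refl) ⟩
      rk M (((Z ∩ (S ─ (X ∩ S))) ∪ (A ─ X)) ∩ (S ─ (X ∩ S))) ∎
      where open ≡-Reasoning

    -- the remaining terms only see Z, which already avoids X
    psRank-deleted : psRank M N A B Z' ≡ psRank (del M (X ∩ S)) (del N (X ∩ T)) (A ─ X) (B ─ X) Z
    psRank-deleted = cong₂ _⊓_
      (cong₂ _+_ span-term (cong (rk N) (by zT' ((v₀ ∩ₑ T') ∩ₑ T') refl)))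
      (cong₂ _+_ (cong₂ _+_ (cong (rk M) (by zS' ((v₀ ∩ₑ S') ∩ₑ S') refl))
                            (cong (rk N) (by (zT' ─ₑ v₅) (((v₀ ∩ₑ T') ─ₑ (v₅ ─ₑ v₁)) ∩ₑ T') refl)))
                 (cong ∣_∣ (by (zT' ∩ₑ v₅) ((v₀ ∩ₑ T') ∩ₑ (v₅ ─ₑ v₁)) refl)))

  deletion-formula : ∀ A₀ X → IsBasis (restrict M A) A₀ → X ⊆ ((S ─ A₀) ∪ T) →
    del (principalSum M N A B) X ≅ principalSum (del M (X ∩ S)) (del N (X ∩ T)) (A ─ X) (B ─ X)
  deletion-formula A₀ X basis X⊆ = ground X , ranks
    where
    module P' = PrincipalSumRank (del M (X ∩ S)) (del N (X ∩ T))
                  (Minors.deletion-isMatroid M isM (X ∩ S)) (Minors.deletion-isMatroid N isN (X ∩ T))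
                  (minors-disjoint X) (A ─ X) (B ─ X) (A─X⊆ X)
    ranks : ∀ Z → Z ⊆ (S ∪ T) ─ X →
      rk (principalSum M N A B) (Z ∩ ((S ∪ T) ─ X))
        ≡ rk (principalSum (del M (X ∩ S)) (del N (X ∩ T)) (A ─ X) (B ─ X)) Z
    ranks Z Z⊆ = begin
      rk (principalSum M N A B) Z'                                          ≡⟨ P.principalSum-rank Z' ⟩
      psRank M N A B Z'                                                     ≡⟨ psRank-deleted ⟩
      psRank (del M (X ∩ S)) (del N (X ∩ T)) (A ─ X) (B ─ X) Z              ≡⟨ sym (P'.principalSum-rank Z) ⟩
      rk (principalSum (del M (X ∩ S)) (del N (X ∩ T)) (A ─ X) (B ─ X)) Z  ∎
      where
      open ≡-Reasoning
      open DeletionRanks A₀ X basis X⊆ Z Z⊆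

  module ContractionRanks (B⊆T : B ⊆ T) (B₀ X : Subset n) (basis : IsBasis (restrict (dual N) B) B₀)
                          (X⊆ : X ⊆ (S ∪ (T ─ B₀))) (Z : Subset n) (Z⊆ : Z ⊆ (S ∪ T) ─ X) where
    U V XS XT ZS ZT W : Subset n
    U = (Z ∩ ((S ∪ T) ─ X)) ∪ (X ∩ (S ∪ T))
    V = X ∩ (S ∪ T)
    XS = X ∩ S
    XT = X ∩ T
    ZS = Z ∩ S
    ZT = Z ∩ T
    W  = (ZT ─ B) ∪ XT
    m₁ n₁ m₂ nWB zb xb mx nx nW : ℕ
    m₁  = rk M ((ZS ∪ XS) ∪ A)
    n₁  = rk N (ZT ∪ XT)
    m₂  = rk M (ZS ∪ XS)
    nWB = rk N ((ZT ∪ XT) ─ B)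
    zb  = ∣ ZT ∩ B ∣
    xb  = ∣ XT ∩ B ∣
    mx  = rk M XS
    nx  = rk N XT
    nW  = rk N W

    private
      hs : List (SetExpr 7)
      hs = (v₀ ─ₑ ((v₂ ∪ₑ v₃) ─ₑ v₁)) ∷ (v₄ ─ₑ v₂) ∷ (v₂ ∩ₑ v₃) ∷ (v₁ ─ₑ (v₂ ∪ₑ (v₃ ─ₑ v₆)))
           ∷ (v₆ ─ₑ (v₅ ∩ₑ v₃)) ∷ (v₅ ─ₑ v₃) ∷ []
      ρ : Vec (Subset n) 7
      ρ = Z ∷ X ∷ S ∷ T ∷ A ∷ B ∷ B₀ ∷ []
      xS xT zS zT S' T' u v w : SetExpr 7
      xS = v₁ ∩ₑ v₂
      xT = v₁ ∩ₑ v₃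
      zS = v₀ ∩ₑ v₂
      zT = v₀ ∩ₑ v₃
      S' = v₂ ─ₑ xS
      T' = v₃ ─ₑ xT
      u  = (v₀ ∩ₑ ((v₂ ∪ₑ v₃) ─ₑ v₁)) ∪ₑ (v₁ ∩ₑ (v₂ ∪ₑ v₃))
      v  = v₁ ∩ₑ (v₂ ∪ₑ v₃)
      w  = (zT ─ₑ v₅) ∪ₑ xT
      module RM = RankFacts M isM
      module RN = RankFacts N isN
      by : (a b : SetExpr 7) → valid 7 hs a b ≡ true → ⟦ a ⟧ ρ ≡ ⟦ b ⟧ ρ
      by a b ok = sound hs a b ok ρ (⊆⇒─≡⊥ Z⊆ , ⊆⇒─≡⊥ A⊆S , S∩T≡⊥ , ⊆⇒─≡⊥ X⊆ ,
                                     ⊆⇒─≡⊥ (proj₁ (proj₁ basis)) , ⊆⇒─≡⊥ B⊆T , tt)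
      by-⊆ : (a b : SetExpr 7) → valid 7 hs (a ─ₑ b) ∅ₑ ≡ true → ⟦ a ⟧ ρ ⊆ ⟦ b ⟧ ρ
      by-⊆ a b ok = ─≡⊥⇒⊆ (by (a ─ₑ b) ∅ₑ ok)

    ZS∪XS⊆S : ZS ∪ XS ⊆ S
    ZS∪XS⊆S = ∪-least (p∩q⊆q Z S) (p∩q⊆q X S)
    W⊆T : W ⊆ T
    W⊆T = ∪-least (⊆-trans (p─q⊆p ZT B) (p∩q⊆q Z T)) (p∩q⊆q X T)

    mx≤m₁ : mx ≤ m₁
    mx≤m₁ = RM.rank-mono (by-⊆ xS ((zS ∪ₑ xS) ∪ₑ v₄) refl) (∪-least ZS∪XS⊆S A⊆S)
    mx≤m₂ : mx ≤ m₂
    mx≤m₂ = RM.rank-mono (by-⊆ xS (zS ∪ₑ xS) refl) ZS∪XS⊆S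
    nx≤n₁ : nx ≤ n₁
    nx≤n₁ = RN.rank-mono (by-⊆ xT (zT ∪ₑ xT) refl) (∪-least (p∩q⊆q Z T) (p∩q⊆q X T))
    nx≤nW : nx ≤ nW
    nx≤nW = RN.rank-mono (by-⊆ xT w refl) W⊆T

    -- W and X_T avoid B₀, so their elements in B are free in N.
    nW≡ : nW ≡ nWB + xb
    nW≡ = trans (Minors.rank-avoiding-cobasis N isN B B₀ B⊆T basis W W⊆T (by (w ∩ₑ v₆) ∅ₑ refl))
                (cong₂ (λ p q → rk N p + ∣ q ∣) (by (w ─ₑ v₅) ((zT ∪ₑ xT) ─ₑ v₅) refl) (by (w ∩ₑ v₅) (xT ∩ₑ v₅) refl))
    nx≡ : nx ≡ rk N (XT ─ B) + xb
    nx≡ = Minors.rank-avoiding-cobasis N isN B B₀ B⊆T basis XT (p∩q⊆q X T) (by (xT ∩ₑ v₆) ∅ₑ refl)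

    psRank-U : psRank M N A B U ≡ (m₁ + n₁) ⊓ (m₂ + nWB + (zb + xb))
    psRank-U = trans (cong₂ (λ s t → (rk M (s ∪ A) + rk N t) ⊓ (rk M s + rk N (t ─ B) + ∣ t ∩ B ∣))
                       (by (u ∩ₑ v₂) (zS ∪ₑ xS) refl) (by (u ∩ₑ v₃) (zT ∪ₑ xT) refl))
                     (cong (λ y → (m₁ + n₁) ⊓ (m₂ + nWB + y))
                       (trans (cong ∣_∣ (by ((zT ∪ₑ xT) ∩ₑ v₅) ((zT ∩ₑ v₅) ∪ₑ (xT ∩ₑ v₅)) refl))
                              (∣∪∣-disjoint (ZT ∩ B) (XT ∩ B) (by ((zT ∩ₑ v₅) ∩ₑ (xT ∩ₑ v₅)) ∅ₑ refl))))

    -- On the contracted set itself the B-term of psRank is the smaller one.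
    psRank-V : psRank M N A B V ≡ mx + nx
    psRank-V = begin
      psRank M N A B V
        ≡⟨ cong₂ (λ s t → (rk M (s ∪ A) + rk N t) ⊓ (rk M s + rk N (t ─ B) + ∣ t ∩ B ∣))
                 (by (v ∩ₑ v₂) xS refl) (by (v ∩ₑ v₃) xT refl) ⟩
      (rk M (XS ∪ A) + nx) ⊓ (mx + rk N (XT ─ B) + xb)
        ≡⟨ cong ((rk M (XS ∪ A) + nx) ⊓_) (trans (+-assoc mx (rk N (XT ─ B)) xb) (cong (mx +_) (sym nx≡))) ⟩
      (rk M (XS ∪ A) + nx) ⊓ (mx + nx)
        ≡⟨ m≥n⇒m⊓n≡n (+-monoˡ-≤ nx (RM.rank-mono (p⊆p∪q A) (∪-least (p∩q⊆q X S) A⊆S))) ⟩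
      mx + nx ∎
      where open ≡-Reasoning

    psRank-contracted : psRank (con M XS) (con N XT) (A ─ X) (B ─ X) Z
                        ≡ ((m₁ ∸ mx) + (n₁ ∸ nx)) ⊓ ((m₂ ∸ mx) + (nW ∸ nx) + zb)
    psRank-contracted = cong₂ _⊓_
      (cong₂ _+_ (cong₂ _∸_ (cong (rk M) (by ((((v₀ ∩ₑ S') ∪ₑ (v₄ ─ₑ v₁)) ∩ₑ S') ∪ₑ (xS ∩ₑ v₂)) ((zS ∪ₑ xS) ∪ₑ v₄) refl))
                            (cong (rk M) (by (xS ∩ₑ v₂) xS refl)))
                 (cong₂ _∸_ (cong (rk N) (by (((v₀ ∩ₑ T') ∩ₑ T') ∪ₑ (xT ∩ₑ v₃)) (zT ∪ₑ xT) refl))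
                            (cong (rk N) (by (xT ∩ₑ v₃) xT refl))))
      (cong₂ _+_
        (cong₂ _+_ (cong₂ _∸_ (cong (rk M) (by (((v₀ ∩ₑ S') ∩ₑ S') ∪ₑ (xS ∩ₑ v₂)) (zS ∪ₑ xS) refl))
                              (cong (rk M) (by (xS ∩ₑ v₂) xS refl)))
                   (cong₂ _∸_ (cong (rk N) (by ((((v₀ ∩ₑ T') ─ₑ (v₅ ─ₑ v₁)) ∩ₑ T') ∪ₑ (xT ∩ₑ v₃)) w refl))
                              (cong (rk N) (by (xT ∩ₑ v₃) xT refl))))
        (cong ∣_∣ (by ((v₀ ∩ₑ T') ∩ₑ (v₅ ─ₑ v₁)) (zT ∩ₑ v₅) refl)))

  contraction-formula : B ⊆ T → ∀ B₀ X → IsBasis (restrict (dual N) B) B₀ → X ⊆ (S ∪ (T ─ B₀)) →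
    con (principalSum M N A B) X ≅ principalSum (con M (X ∩ S)) (con N (X ∩ T)) (A ─ X) (B ─ X)
  contraction-formula B⊆T B₀ X basis X⊆ = ground X , ranks
    where
    module P' = PrincipalSumRank (con M (X ∩ S)) (con N (X ∩ T))
                  (Minors.contraction-isMatroid M isM (X ∩ S)) (Minors.contraction-isMatroid N isN (X ∩ T))
                  (minors-disjoint X) (A ─ X) (B ─ X) (A─X⊆ X)
    ranks : ∀ Z → Z ⊆ (S ∪ T) ─ X →
      rk (principalSum M N A B) ((Z ∩ ((S ∪ T) ─ X)) ∪ (X ∩ (S ∪ T))) ∸ rk (principalSum M N A B) (X ∩ (S ∪ T))
        ≡ rk (principalSum (con M (X ∩ S)) (con N (X ∩ T)) (A ─ X) (B ─ X)) Z
    ranks Z Z⊆ = begin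
      rk (principalSum M N A B) U ∸ rk (principalSum M N A B) V
        ≡⟨ cong₂ _∸_ (trans (P.principalSum-rank U) psRank-U) (trans (P.principalSum-rank V) psRank-V) ⟩
      ((m₁ + n₁) ⊓ (m₂ + nWB + (zb + xb))) ∸ (mx + nx)
        ≡⟨ ∸-⊓-contract mx≤m₁ nx≤n₁ mx≤m₂ nx≤nW nW≡ ⟩
      ((m₁ ∸ mx) + (n₁ ∸ nx)) ⊓ ((m₂ ∸ mx) + (nW ∸ nx) + zb)
        ≡⟨ sym (trans (P'.principalSum-rank Z) psRank-contracted) ⟩
      rk (principalSum (con M (X ∩ S)) (con N (X ∩ T)) (A ─ X) (B ─ X)) Z ∎
      where
      open ≡-Reasoning
      open ContractionRanks B⊆T B₀ X basis X⊆ Z Z⊆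

corollary3p9 : ∀ {n} (M N : RankData n) → IsMatroid M → IsMatroid N →
    Disjoint (E M) (E N) → (A B : Subset n) → A ⊆ E M → B ⊆ E N →
    (∀ A₀ X → IsBasis (restrict M A) A₀ → X ⊆ ((E M ─ A₀) ∪ E N) →
      del (principalSum M N A B) X
        ≅ principalSum (del M (X ∩ E M)) (del N (X ∩ E N)) (A ─ X) (B ─ X))
    ×
    (∀ B₀ X → IsBasis (restrict (dual N) B) B₀ → X ⊆ (E M ∪ (E N ─ B₀)) →
      con (principalSum M N A B) X
        ≅ principalSum (con M (X ∩ E M)) (con N (X ∩ E N)) (A ─ X) (B ─ X))
corollary3p9 M N isM isN S∩T-empty A B A⊆S B⊆T = deletion-formula , contraction-formula B⊆T
  where open MinorSetting M N isM isN (Empty-unique S∩T-empty) A B A⊆S
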